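{- There exists an absolute constant $\varepsilon>0$ such that for every $0<p<1$ and every graph $G$ on $n\ge 4$ vertices, $u_4(G,p)\ge \varepsilon\, p(1-p)\, n^2$.
   Context: For graphs $F,G$, $N(F,G)$ denotes the number of induced subgraphs of $G$ isomorphic to $F$. $\mathcal{G}(n,p)$ is the Erdős–Rényi random graph on $n$ vertices with edge probability $p$. For a graph $G$ on $n$ vertices, $u_4(G,p):=\max\{N(F,G)-\mathbb{E}[N(F,\mathcal{G}(n,p))] : F \text{ a graph with } v(F)=4\}$.
   Formalization: The edge probability p ranges over the rationals in (0,1), and the constant ε is taken in the positive rationals. -}

module Defs where

open import Data.Bool using (Bool; true; false; _∧_; _∨_; not)
open import Data.Nat as ℕ using (ℕ; zero; suc)
open import Data.Fin using (Fin; zero; suc; toℕ)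
open import Data.List using (List; []; _∷_; map; concatMap; filterᵇ; length; foldr; allFin; _++_)
open import Data.Bool.ListAction using (any; all)
open import Data.Product using (_×_; _,_)
open import Data.Integer using (+_)
open import Data.Rational using (ℚ; 0ℚ; 1ℚ; _+_; _*_; _-_; _⊔_; _/_)
open import Relation.Binary.PropositionalEquality using (_≡_)

Adj : ℕ → Set
Adj n = Fin n → Fin n → Bool

record SimpleGraph (n : ℕ) : Set where
  field
    adj    : Adj n
    sym    : ∀ i j → adj i j ≡ adj j i
    irrefl : ∀ i → adj i i ≡ false

_==ᵇ_ : Bool → Bool → Bool
true  ==ᵇ b = b
false ==ᵇ b = not b

_<ᶠ_ : ∀ {n} → Fin n → Fin n → Bool
i <ᶠ j = toℕ i ℕ.<ᵇ toℕ j

_=ᶠ_ : ∀ {n} → Fin n → Fin n → Bool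
i =ᶠ j = toℕ i ℕ.≡ᵇ toℕ j

-- 4-vertex subsets {a<b<c<d} of Fin n, viewed as maps Fin 4 → Fin n

Quad : ℕ → Set
Quad n = Fin n × Fin n × Fin n × Fin n

quadFun : ∀ {n} → Quad n → Fin 4 → Fin n
quadFun (a , b , c , d) zero                   = a
quadFun (a , b , c , d) (suc zero)             = b
quadFun (a , b , c , d) (suc (suc zero))       = c
quadFun (a , b , c , d) (suc (suc (suc zero))) = d

allQuads : ∀ n → List (Quad n)
allQuads n =
  concatMap (λ a → concatMap (λ b → concatMap (λ c → map (λ d → (a , b , c , d))
    (allFin n)) (allFin n)) (allFin n)) (allFin n)

increasing : ∀ {n} → Quad n → Bool
increasing (a , b , c , d) = (a <ᶠ b) ∧ ((b <ᶠ c) ∧ (c <ᶠ d))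

fourSets : ∀ n → List (Quad n)
fourSets n = filterᵇ increasing (allQuads n)

distinct4 : Quad 4 → Bool
distinct4 q = all (λ i → all (λ j → (i =ᶠ j) ∨ not (quadFun q i =ᶠ quadFun q j))
                                 (allFin 4)) (allFin 4)

perms4 : List (Fin 4 → Fin 4)
perms4 = map quadFun (filterᵇ distinct4 (allQuads 4))

isIso4 : Adj 4 → Adj 4 → Bool
isIso4 F H = any (λ σ → all (λ i → all (λ j → F (σ i) (σ j) ==ᵇ H i j)
                                     (allFin 4)) (allFin 4)) perms4

induced : ∀ {n} → Adj n → (Fin 4 → Fin n) → Adj 4
induced G v i j = G (v i) (v j)

N : ∀ {n} → Adj 4 → Adj n → ℕ
N {n} F G = length (filterᵇ (λ q → isIso4 F (induced G (quadFun q))) (fourSets n))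

-- The random graph G(n,p): sample space = all labelled graphs on Fin n,
-- given by their edge sets (subsets of the pairs i<j).

pairs : ∀ n → List (Fin n × Fin n)
pairs n = filterᵇ (λ { (i , j) → i <ᶠ j })
            (concatMap (λ i → map (λ j → (i , j)) (allFin n)) (allFin n))

subsets : ∀ {A : Set} → List A → List (List A)
subsets []       = [] ∷ []
subsets (x ∷ xs) = let s = subsets xs in s ++ map (x ∷_) s

adjOf : ∀ {n} → List (Fin n × Fin n) → Adj n
adjOf E i j = any (λ { (a , b) → ((a =ᶠ i) ∧ (b =ᶠ j)) ∨ ((a =ᶠ j) ∧ (b =ᶠ i)) }) E

ℕtoℚ : ℕ → ℚ
ℕtoℚ k = (+ k) / 1

_^ℚ_ : ℚ → ℕ → ℚ
x ^ℚ zero  = 1ℚ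
x ^ℚ suc k = x * (x ^ℚ k)

sumℚ : List ℚ → ℚ
sumℚ = foldr _+_ 0ℚ

probEdgeSet : ∀ n → ℚ → List (Fin n × Fin n) → ℚ
probEdgeSet n p E = (p ^ℚ length E) * ((1ℚ - p) ^ℚ (length (pairs n) ℕ.∸ length E))

expectedN : ∀ n → ℚ → Adj 4 → ℚ
expectedN n p F =
  sumℚ (map (λ E → probEdgeSet n p E * ℕtoℚ (N F (adjOf {n} E))) (subsets (pairs n)))

graphs4 : List (Adj 4)
graphs4 = map adjOf (subsets (pairs 4))

maxℚ : ℚ → List ℚ → ℚ
maxℚ x xs = foldr _⊔_ x xs

emptyAdj4 : Adj 4
emptyAdj4 _ _ = false

u4 : ∀ {n} → Adj n → ℚ → ℚ
u4 {n} G p = maxℚ (dev emptyAdj4) (map dev graphs4)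
  where
    dev : Adj 4 → ℚ
    dev F = ℕtoℚ (N F G) - expectedN n p F

{-# OPTIONS --safe #-}
module Submission where

-- Let d F = N(F,G) − 𝔼 N(F,G(n,p)) for the eleven isomorphism classes F of graphs on four
-- vertices. Then d F ≤ u₄ for all F, and ∑ d F = 0 because both N(·,G) and N(·,G(n,p)) add up to
-- the number of 4-sets. For a statistic f of 4-vertex graphs, ∑ f(F) N(F,G) is the sum of
-- f(G[S]) over the 4-sets S, and 0 ≤ f ≤ c gives −∑ (c − f F) · u₄ ≤ ∑ f(F) d F ≤ ∑ f F · u₄.
-- Take f = number of edges, of perfect matchings and of two-edge paths. Double counting turns
-- the weighted deviations into polynomials in n, p, the number e of edges and the number of
-- two-edge paths of G: with D = 2e − p n(n−1), the edge statistic gives ¼ (n−2)(n−3) D, and a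
-- combination of the other two gives ⅛ (n−3) (D² + 2 (p n(n−1) − 1) D − 2 n(n−1) p(1−p)).
-- Either (n−2)(n−3) ≤ 132 u₄, or |D| < 1 and then the second identity forces
-- n(n−1) p(1−p) ≤ 1359 u₄; in both cases u₄ ≥ p(1−p) n² / 2000.

module IncreasingSums where

  open import Defs using (_<ᶠ_)
  open import Data.Bool using (true; false; if_then_else_)
  open import Data.Nat using (ℕ; zero; suc; _+_; _*_)
  open import Data.Nat.Properties using (+-*-semiring; *-comm; +-assoc; +-identityʳ; *-distribʳ-+; +-cancelʳ-≡)
  open import Data.Nat.Tactic.RingSolver using (solve-∀; solve)
  open import Data.List using ([]; _∷_)
  open import Data.Fin using (Fin; zero; suc)
  open import Algebra.Properties.Semiring.Sum +-*-semiring
    using (sum; sum-syntax; sum-cong-≗; ∑-distrib-+; *-distribˡ-sum)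
  open import Relation.Binary.PropositionalEquality

  -- Going through ∑> (the sum over
  -- the elements above i) makes the recursion on n definitional: ∑₄ (suc n) f unfolds to the ∑₃
  -- over the tuples starting at zero plus the ∑₄ over the shifted ones.
  ∑> : ∀ {n} → Fin n → (Fin n → ℕ) → ℕ
  ∑> i f = sum λ x → if i <ᶠ x then f x else 0

  ∑₂ : ∀ n → (Fin n → Fin n → ℕ) → ℕ
  ∑₂ n f = ∑[ a < n ] ∑> a (f a)

  ∑₃ : ∀ n → (Fin n → Fin n → Fin n → ℕ) → ℕ
  ∑₃ n f = ∑[ a < n ] ∑> a λ b → ∑> b (f a b)

  ∑₄ : ∀ n → (Fin n → Fin n → Fin n → Fin n → ℕ) → ℕ
  ∑₄ n f = ∑[ a < n ] ∑> a λ b → ∑> b λ c → ∑> c (f a b c)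

  ∑-const : ∀ n c → ∑[ _ < n ] c ≡ n * c
  ∑-const zero    c = refl
  ∑-const (suc n) c = cong (c +_) (∑-const n c)

  ∑-distribˡ-* : ∀ {n} c (f : Fin n → ℕ) → ∑[ x < n ] (c * f x) ≡ c * sum f
  ∑-distribˡ-* c f = sym (*-distribˡ-sum c f)

  ∑>-cong : ∀ {n} (i : Fin n) {f g : Fin n → ℕ} → f ≗ g → ∑> i f ≡ ∑> i g
  ∑>-cong i f≗g = sum-cong-≗ λ x → cong (λ y → if i <ᶠ x then y else 0) (f≗g x)

  ∑>-distrib-+ : ∀ {n} (i : Fin n) (f g : Fin n → ℕ) → ∑> i (λ x → f x + g x) ≡ ∑> i f + ∑> i g
  ∑>-distrib-+ i f g = trans (sum-cong-≗ λ x → if-+ (i <ᶠ x))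
    (∑-distrib-+ (λ x → if i <ᶠ x then f x else 0) (λ x → if i <ᶠ x then g x else 0))
    where
    if-+ : ∀ b {x y} → (if b then x + y else 0) ≡ (if b then x else 0) + (if b then y else 0)
    if-+ true  = refl
    if-+ false = refl

  ∑>-distribˡ-* : ∀ {n} (i : Fin n) c (f : Fin n → ℕ) → ∑> i (λ x → c * f x) ≡ c * ∑> i f
  ∑>-distribˡ-* i c f = trans (sum-cong-≗ λ x → if-* (i <ᶠ x))
    (∑-distribˡ-* c (λ x → if i <ᶠ x then f x else 0))
    where
    if-* : ∀ b {x} → (if b then c * x else 0) ≡ c * (if b then x else 0)
    if-* true  = refl
    if-* false = sym (*-comm c 0)

  ∑₂-cong : ∀ n {f g : Fin n → Fin n → ℕ} → (∀ a b → f a b ≡ g a b) → ∑₂ n f ≡ ∑₂ n g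
  ∑₂-cong n e = sum-cong-≗ λ a → ∑>-cong a (e a)

  ∑₄-cong : ∀ n {f g : Fin n → Fin n → Fin n → Fin n → ℕ} →
            (∀ a b c d → f a b c d ≡ g a b c d) → ∑₄ n f ≡ ∑₄ n g
  ∑₄-cong n e = sum-cong-≗ λ a → ∑>-cong a λ b → ∑>-cong b λ c → ∑>-cong c (e a b c)

  ∑₂-distrib-+ : ∀ n (f g : Fin n → Fin n → ℕ) → ∑₂ n (λ a b → f a b + g a b) ≡ ∑₂ n f + ∑₂ n g
  ∑₂-distrib-+ n f g = trans (sum-cong-≗ λ a → ∑>-distrib-+ a (f a) (g a))
    (∑-distrib-+ (λ a → ∑> a (f a)) (λ a → ∑> a (g a)))

  ∑₂-distribˡ-* : ∀ n c (f : Fin n → Fin n → ℕ) → ∑₂ n (λ a b → c * f a b) ≡ c * ∑₂ n f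
  ∑₂-distribˡ-* n c f = trans (sum-cong-≗ λ a → ∑>-distribˡ-* a c (f a)) (∑-distribˡ-* c λ a → ∑> a (f a))

  ∑₃-distrib-+ : ∀ n (f g : Fin n → Fin n → Fin n → ℕ) →
                 ∑₃ n (λ a b c → f a b c + g a b c) ≡ ∑₃ n f + ∑₃ n g
  ∑₃-distrib-+ n f g = trans
    (sum-cong-≗ λ a → trans (∑>-cong a λ b → ∑>-distrib-+ b (f a b) (g a b)) (∑>-distrib-+ a _ _))
    (∑-distrib-+ (λ a → ∑> a λ b → ∑> b (f a b)) (λ a → ∑> a λ b → ∑> b (g a b)))

  ∑₂-const : ∀ n c → 2 * ∑₂ n (λ _ _ → c) + n * c ≡ n * n * c
  ∑₂-const zero    c = refl
  ∑₂-const (suc n) c = step (∑₂ n (λ _ _ → c)) (∑₂-const n c)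
    where
    open ≡-Reasoning
    step : ∀ S → 2 * S + n * c ≡ n * n * c → 2 * (∑[ _ < n ] c + S) + suc n * c ≡ suc n * suc n * c
    step S ih = begin
      2 * (∑[ _ < n ] c + S) + suc n * c  ≡⟨ cong (λ z → 2 * (z + S) + suc n * c) (∑-const n c) ⟩
      2 * (n * c + S) + suc n * c         ≡⟨ solve (n ∷ c ∷ S ∷ []) ⟩
      2 * n * c + c + (2 * S + n * c)     ≡⟨ cong (2 * n * c + c +_) ih ⟩
      2 * n * c + c + n * n * c           ≡⟨ solve (n ∷ c ∷ []) ⟩
      suc n * suc n * c                   ∎

  ∑₃-ones : ∀ n → 6 * ∑₃ n (λ _ _ _ → 1) + 3 * n * n ≡ n * n * n + 2 * n
  ∑₃-ones zero    = refl
  ∑₃-ones (suc n) = step (∑₂ n λ _ _ → 1) (∑₃ n λ _ _ _ → 1) (∑₂-const n 1) (∑₃-ones n)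
    where
    open ≡-Reasoning
    step : ∀ T S → 2 * T + n * 1 ≡ n * n * 1 → 6 * S + 3 * n * n ≡ n * n * n + 2 * n →
           6 * (T + S) + 3 * suc n * suc n ≡ suc n * suc n * suc n + 2 * suc n
    step T S count₂ ih = +-cancelʳ-≡ (3 * n) _ _ (begin
      6 * (T + S) + 3 * suc n * suc n + 3 * n                      ≡⟨ solve (n ∷ T ∷ S ∷ []) ⟩
      3 * (2 * T + n * 1) + (6 * S + 3 * n * n) + 6 * n + 3        ≡⟨ cong₂ (λ a b → 3 * a + b + 6 * n + 3) count₂ ih ⟩
      3 * (n * n * 1) + (n * n * n + 2 * n) + 6 * n + 3            ≡⟨ solve (n ∷ []) ⟩
      suc n * suc n * suc n + 2 * suc n + 3 * n                    ∎)

  ∑₄-ones : ∀ n → 24 * ∑₄ n (λ _ _ _ _ → 1) + 6 * n * n * n + 6 * n ≡ n * n * n * n + 11 * n * n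
  ∑₄-ones zero    = refl
  ∑₄-ones (suc n) = step (∑₃ n λ _ _ _ → 1) (∑₄ n λ _ _ _ _ → 1) (∑₃-ones n) (∑₄-ones n)
    where
    open ≡-Reasoning
    step : ∀ T S → 6 * T + 3 * n * n ≡ n * n * n + 2 * n →
           24 * S + 6 * n * n * n + 6 * n ≡ n * n * n * n + 11 * n * n →
           24 * (T + S) + 6 * suc n * suc n * suc n + 6 * suc n ≡ suc n * suc n * suc n * suc n + 11 * suc n * suc n
    step T S count₃ ih = +-cancelʳ-≡ (12 * n * n + 6 * n * n * n + 14 * n) _ _ (begin
      24 * (T + S) + 6 * suc n * suc n * suc n + 6 * suc n + (12 * n * n + 6 * n * n * n + 14 * n)
        ≡⟨ solve (n ∷ T ∷ S ∷ []) ⟩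
      4 * (6 * T + 3 * n * n) + (24 * S + 6 * n * n * n + 6 * n) + 6 * suc n * suc n * suc n + 14 * n + 6
        ≡⟨ cong₂ (λ a b → 4 * a + b + 6 * suc n * suc n * suc n + 14 * n + 6) count₃ ih ⟩
      4 * (n * n * n + 2 * n) + (n * n * n * n + 11 * n * n) + 6 * suc n * suc n * suc n + 14 * n + 6
        ≡⟨ solve (n ∷ []) ⟩
      suc n * suc n * suc n * suc n + 11 * suc n * suc n + (12 * n * n + 6 * n * n * n + 14 * n) ∎)

  ∑₂-ends : ∀ n (h : Fin n → ℕ) → ∑₂ n (λ c d → h c + h d) + sum h ≡ n * sum h
  ∑₂-ends zero    h = refl
  ∑₂-ends (suc n) h =
    trans (cong (λ z → z + ∑₂ n (λ c d → h′ c + h′ d) + (h zero + sum h′)) row)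
          (step (h zero) (sum h′) (∑₂ n λ c d → h′ c + h′ d) (∑₂-ends n h′))
    where
    open ≡-Reasoning
    h′ = λ x → h (suc x)
    row : ∑[ d < n ] (h zero + h′ d) ≡ n * h zero + sum h′
    row = trans (∑-distrib-+ (λ _ → h zero) h′) (cong (_+ sum h′) (∑-const n (h zero)))
    step : ∀ h₀ H S → S + H ≡ n * H → n * h₀ + H + S + (h₀ + H) ≡ suc n * (h₀ + H)
    step h₀ H S ih = begin
      n * h₀ + H + S + (h₀ + H)    ≡⟨ solve (n ∷ h₀ ∷ H ∷ S ∷ []) ⟩
      n * h₀ + h₀ + H + (S + H)    ≡⟨ cong (n * h₀ + h₀ + H +_) ih ⟩
      n * h₀ + h₀ + H + n * H      ≡⟨ solve (n ∷ h₀ ∷ H ∷ []) ⟩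
      suc n * (h₀ + H)             ∎

  ∑₃-vertices : ∀ n (h : Fin n → ℕ) →
                2 * ∑₃ n (λ b c d → h b + h c + h d) + 3 * n * sum h ≡ n * n * sum h + 2 * sum h
  ∑₃-vertices zero    h = refl
  ∑₃-vertices (suc n) h =
    trans (cong (λ z → 2 * (z + ∑₃ n (λ b c d → h′ b + h′ c + h′ d)) + 3 * suc n * (h zero + sum h′)) split)
          (step (h zero) (sum h′) (∑₂ n λ _ _ → h zero) (∑₂ n λ c d → h′ c + h′ d) (∑₃ n λ b c d → h′ b + h′ c + h′ d)
                (∑₂-const n (h zero)) (∑₂-ends n h′) (∑₃-vertices n h′))
    where
    open ≡-Reasoning
    h′ = λ x → h (suc x)
    split : ∑₂ n (λ c d → h zero + h′ c + h′ d) ≡ ∑₂ n (λ _ _ → h zero) + ∑₂ n (λ c d → h′ c + h′ d)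
    split = trans (∑₂-cong n λ c d → +-assoc (h zero) (h′ c) (h′ d)) (∑₂-distrib-+ n _ _)
    step : ∀ h₀ H T A S → 2 * T + n * h₀ ≡ n * n * h₀ → A + H ≡ n * H → 2 * S + 3 * n * H ≡ n * n * H + 2 * H →
           2 * (T + A + S) + 3 * suc n * (h₀ + H) ≡ suc n * suc n * (h₀ + H) + 2 * (h₀ + H)
    step h₀ H T A S const ends ih = +-cancelʳ-≡ (n * h₀ + 2 * H + 3 * n * H) _ _ (begin
      2 * (T + A + S) + 3 * suc n * (h₀ + H) + (n * h₀ + 2 * H + 3 * n * H)
        ≡⟨ solve (n ∷ h₀ ∷ H ∷ T ∷ A ∷ S ∷ []) ⟩
      (2 * T + n * h₀) + 2 * (A + H) + (2 * S + 3 * n * H) + 3 * suc n * (h₀ + H)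
        ≡⟨ cong₂ (λ a b → a + 2 * b + (2 * S + 3 * n * H) + 3 * suc n * (h₀ + H)) const ends ⟩
      n * n * h₀ + 2 * (n * H) + (2 * S + 3 * n * H) + 3 * suc n * (h₀ + H)
        ≡⟨ cong (λ c → n * n * h₀ + 2 * (n * H) + c + 3 * suc n * (h₀ + H)) ih ⟩
      n * n * h₀ + 2 * (n * H) + (n * n * H + 2 * H) + 3 * suc n * (h₀ + H)
        ≡⟨ solve (n ∷ h₀ ∷ H ∷ []) ⟩
      suc n * suc n * (h₀ + H) + 2 * (h₀ + H) + (n * h₀ + 2 * H + 3 * n * H) ∎)

  ∑₃-edges : ∀ n (g : Fin n → Fin n → ℕ) →
             ∑₃ n (λ b c d → g b c + g b d + g c d) + 2 * ∑₂ n g ≡ n * ∑₂ n g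
  ∑₃-edges zero    g = refl
  ∑₃-edges (suc n) g =
    trans (cong (λ z → z + ∑₃ n (λ b c d → g′ b c + g′ b d + g′ c d) + 2 * (sum k + ∑₂ n g′))
                (∑₂-distrib-+ n (λ c d → k c + k d) g′))
          (step (sum k) (∑₂ n g′) (∑₂ n λ c d → k c + k d) (∑₃ n λ b c d → g′ b c + g′ b d + g′ c d)
                (∑₂-ends n k) (∑₃-edges n g′))
    where
    open ≡-Reasoning
    k = λ x → g zero (suc x)
    g′ = λ x y → g (suc x) (suc y)
    step : ∀ K E A S → A + K ≡ n * K → S + 2 * E ≡ n * E → A + E + S + 2 * (K + E) ≡ suc n * (K + E)
    step K E A S ends ih = begin
      A + E + S + 2 * (K + E)           ≡⟨ solve (K ∷ E ∷ A ∷ S ∷ []) ⟩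
      (A + K) + K + (S + 2 * E) + E     ≡⟨ cong₂ (λ a b → a + K + b + E) ends ih ⟩
      n * K + K + n * E + E             ≡⟨ solve (n ∷ K ∷ E ∷ []) ⟩
      suc n * (K + E)                   ∎

  ∑₄-edges : ∀ n (g : Fin n → Fin n → ℕ) →
             2 * ∑₄ n (λ a b c d → (g a b + g a c + g a d) + (g b c + g b d + g c d)) + 5 * n * ∑₂ n g
             ≡ n * n * ∑₂ n g + 6 * ∑₂ n g
  ∑₄-edges zero    g = refl
  ∑₄-edges (suc n) g =
    trans (cong (λ z → 2 * (z + ∑₄ n (λ a b c d → (g′ a b + g′ a c + g′ a d) + (g′ b c + g′ b d + g′ c d)))
                       + 5 * suc n * (sum k + ∑₂ n g′))
                (∑₃-distrib-+ n (λ b c d → k b + k c + k d) (λ b c d → g′ b c + g′ b d + g′ c d)))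
          (step (sum k) (∑₂ n g′) (∑₃ n λ b c d → k b + k c + k d) (∑₃ n λ b c d → g′ b c + g′ b d + g′ c d)
                (∑₄ n λ a b c d → (g′ a b + g′ a c + g′ a d) + (g′ b c + g′ b d + g′ c d))
                (∑₃-vertices n k) (∑₃-edges n g′) (∑₄-edges n g′))
    where
    open ≡-Reasoning
    k = λ x → g zero (suc x)
    g′ = λ x y → g (suc x) (suc y)
    step : ∀ K E U V S → 2 * U + 3 * n * K ≡ n * n * K + 2 * K → V + 2 * E ≡ n * E →
           2 * S + 5 * n * E ≡ n * n * E + 6 * E →
           2 * (U + V + S) + 5 * suc n * (K + E) ≡ suc n * suc n * (K + E) + 6 * (K + E)
    step K E U V S vertices edges ih = +-cancelʳ-≡ (3 * n * K + 4 * E + 5 * n * E) _ _ (begin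
      2 * (U + V + S) + 5 * suc n * (K + E) + (3 * n * K + 4 * E + 5 * n * E)
        ≡⟨ solve (n ∷ K ∷ E ∷ U ∷ V ∷ S ∷ []) ⟩
      (2 * U + 3 * n * K) + 2 * (V + 2 * E) + (2 * S + 5 * n * E) + 5 * suc n * (K + E)
        ≡⟨ cong₂ (λ a b → a + 2 * b + (2 * S + 5 * n * E) + 5 * suc n * (K + E)) vertices edges ⟩
      (n * n * K + 2 * K) + 2 * (n * E) + (2 * S + 5 * n * E) + 5 * suc n * (K + E)
        ≡⟨ cong (λ c → (n * n * K + 2 * K) + 2 * (n * E) + c + 5 * suc n * (K + E)) ih ⟩
      (n * n * K + 2 * K) + 2 * (n * E) + (n * n * E + 6 * E) + 5 * suc n * (K + E)
        ≡⟨ solve (n ∷ K ∷ E ∷ []) ⟩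
      suc n * suc n * (K + E) + 6 * (K + E) + (3 * n * K + 4 * E + 5 * n * E) ∎)

  ∑₄-triples : ∀ n (f : Fin n → Fin n → Fin n → ℕ) →
               ∑₄ n (λ a b c d → (f a b c + f a b d + f a c d) + f b c d) + 3 * ∑₃ n f ≡ n * ∑₃ n f
  ∑₄-triples zero    f = refl
  ∑₄-triples (suc n) f =
    trans (cong (λ z → z + ∑₄ n (λ a b c d → (f′ a b c + f′ a b d + f′ a c d) + f′ b c d)
                       + 3 * (∑₂ n f₀ + ∑₃ n f′))
                (∑₃-distrib-+ n (λ b c d → f₀ b c + f₀ b d + f₀ c d) f′))
          (step (∑₂ n f₀) (∑₃ n f′) (∑₃ n λ b c d → f₀ b c + f₀ b d + f₀ c d)
                (∑₄ n λ a b c d → (f′ a b c + f′ a b d + f′ a c d) + f′ b c d)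
                (∑₃-edges n f₀) (∑₄-triples n f′))
    where
    open ≡-Reasoning
    f₀ = λ x y → f zero (suc x) (suc y)
    f′ = λ x y z → f (suc x) (suc y) (suc z)
    step : ∀ E T A S → A + 2 * E ≡ n * E → S + 3 * T ≡ n * T → A + T + S + 3 * (E + T) ≡ suc n * (E + T)
    step E T A S edges ih = begin
      A + T + S + 3 * (E + T)            ≡⟨ solve (E ∷ T ∷ A ∷ S ∷ []) ⟩
      (A + 2 * E) + E + (S + 3 * T) + T  ≡⟨ cong₂ (λ a b → a + E + b + T) edges ih ⟩
      n * E + E + n * T + T              ≡⟨ solve (n ∷ E ∷ T ∷ []) ⟩
      suc n * (E + T)                    ∎

  ∑-*-∑ : ∀ n (h k : Fin n → ℕ) →
          ∑₂ n (λ c d → h c * k d + h d * k c) + ∑[ x < n ] (h x * k x) ≡ sum h * sum k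
  ∑-*-∑ zero    h k = refl
  ∑-*-∑ (suc n) h k =
    trans (cong (λ z → z + ∑₂ n (λ c d → h′ c * k′ d + h′ d * k′ c) + (h zero * k zero + ∑[ x < n ] (h′ x * k′ x))) row)
          (step (h zero) (k zero) (sum h′) (sum k′) (∑₂ n λ c d → h′ c * k′ d + h′ d * k′ c) (∑[ x < n ] (h′ x * k′ x))
                (∑-*-∑ n h′ k′))
    where
    open ≡-Reasoning
    h′ = λ x → h (suc x)
    k′ = λ x → k (suc x)
    row : ∑[ d < n ] (h zero * k′ d + h′ d * k zero) ≡ h zero * sum k′ + k zero * sum h′
    row = trans (∑-distrib-+ (λ d → h zero * k′ d) (λ d → h′ d * k zero))
                (cong₂ _+_ (∑-distribˡ-* (h zero) k′)
                           (trans (sum-cong-≗ λ d → *-comm (h′ d) (k zero)) (∑-distribˡ-* (k zero) h′)))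
    step : ∀ h₀ k₀ H K S P → S + P ≡ H * K → h₀ * K + k₀ * H + S + (h₀ * k₀ + P) ≡ (h₀ + H) * (k₀ + K)
    step h₀ k₀ H K S P ih = begin
      h₀ * K + k₀ * H + S + (h₀ * k₀ + P)    ≡⟨ solve (h₀ ∷ k₀ ∷ H ∷ K ∷ S ∷ P ∷ []) ⟩
      h₀ * K + k₀ * H + h₀ * k₀ + (S + P)    ≡⟨ cong (h₀ * K + k₀ * H + h₀ * k₀ +_) ih ⟩
      h₀ * K + k₀ * H + h₀ * k₀ + H * K      ≡⟨ solve (h₀ ∷ k₀ ∷ H ∷ K ∷ []) ⟩
      (h₀ + H) * (k₀ + K)                    ∎

  ∑-square : ∀ n (h : Fin n → ℕ) →
             2 * ∑₂ n (λ c d → h c * h d) + ∑[ x < n ] (h x * h x) ≡ sum h * sum h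
  ∑-square n h = trans (cong (_+ ∑[ x < n ] (h x * h x)) twice) (∑-*-∑ n h h)
    where
    twice : 2 * ∑₂ n (λ c d → h c * h d) ≡ ∑₂ n (λ c d → h c * h d + h d * h c)
    twice = sym (begin
      ∑₂ n (λ c d → h c * h d + h d * h c)                ≡⟨ ∑₂-distrib-+ n _ _ ⟩
      ∑₂ n (λ c d → h c * h d) + ∑₂ n (λ c d → h d * h c) ≡⟨ cong (λ z → ∑₂ n (λ c d → h c * h d) + z)
                                                                 (∑₂-cong n λ c d → *-comm (h d) (h c)) ⟩
      ∑₂ n (λ c d → h c * h d) + ∑₂ n (λ c d → h c * h d) ≡⟨ cong (∑₂ n (λ c d → h c * h d) +_)
                                                                 (sym (+-identityʳ _)) ⟩
      2 * ∑₂ n (λ c d → h c * h d)                        ∎)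
      where open ≡-Reasoning

  ∑-*-∑₂ : ∀ n (h : Fin n → ℕ) (g : Fin n → Fin n → ℕ) →
           ∑₃ n (λ b c d → h b * g c d + h c * g b d + h d * g b c) + ∑₂ n (λ c d → (h c + h d) * g c d)
           ≡ sum h * ∑₂ n g
  ∑-*-∑₂ zero    h g = refl
  ∑-*-∑₂ (suc n) h g =
    trans (cong₂ (λ y z → y + ∑₃ n (λ b c d → h′ b * g′ c d + h′ c * g′ b d + h′ d * g′ b c)
                          + (z + ∑₂ n (λ c d → (h′ c + h′ d) * g′ c d))) first row)
          (step (h zero) (sum h′) (sum k) (∑₂ n g′) (∑₂ n λ c d → h′ c * k d + h′ d * k c) (∑[ x < n ] (h′ x * k x))
                (∑₃ n λ b c d → h′ b * g′ c d + h′ c * g′ b d + h′ d * g′ b c) (∑₂ n λ c d → (h′ c + h′ d) * g′ c d)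
                (∑-*-∑ n h′ k) (∑-*-∑₂ n h′ g′))
    where
    open ≡-Reasoning
    h′ = λ x → h (suc x)
    k = λ x → g zero (suc x)
    g′ = λ x y → g (suc x) (suc y)
    first : ∑₂ n (λ c d → h zero * g′ c d + h′ c * k d + h′ d * k c)
            ≡ h zero * ∑₂ n g′ + ∑₂ n (λ c d → h′ c * k d + h′ d * k c)
    first = trans (∑₂-cong n λ c d → +-assoc (h zero * g′ c d) (h′ c * k d) (h′ d * k c))
                  (trans (∑₂-distrib-+ n _ _) (cong (_+ ∑₂ n (λ c d → h′ c * k d + h′ d * k c)) (∑₂-distribˡ-* n (h zero) g′)))
    row : ∑[ d < n ] ((h zero + h′ d) * k d) ≡ h zero * sum k + ∑[ x < n ] (h′ x * k x)
    row = trans (sum-cong-≗ λ d → *-distribʳ-+ (k d) (h zero) (h′ d))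
                (trans (∑-distrib-+ (λ d → h zero * k d) (λ d → h′ d * k d))
                       (cong (_+ ∑[ x < n ] (h′ x * k x)) (∑-distribˡ-* (h zero) k)))
    step : ∀ h₀ H K E C M S D → C + M ≡ H * K → S + D ≡ H * E →
           h₀ * E + C + S + (h₀ * K + M + D) ≡ (h₀ + H) * (K + E)
    step h₀ H K E C M S D cross ih = begin
      h₀ * E + C + S + (h₀ * K + M + D)    ≡⟨ solve (h₀ ∷ K ∷ E ∷ C ∷ M ∷ S ∷ D ∷ []) ⟩
      h₀ * E + (C + M) + (S + D) + h₀ * K  ≡⟨ cong₂ (λ a b → h₀ * E + a + b + h₀ * K) cross ih ⟩
      h₀ * E + H * K + H * E + h₀ * K      ≡⟨ solve (h₀ ∷ H ∷ K ∷ E ∷ []) ⟩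
      (h₀ + H) * (K + E)                   ∎

  ∑₂-square : ∀ n (g : Fin n → Fin n → ℕ) →
              2 * ∑₄ n (λ a b c d → g a b * g c d + g a c * g b d + g a d * g b c)
              + 2 * ∑₃ n (λ b c d → g b c * g b d + g b c * g c d + g b d * g c d)
              + ∑₂ n (λ a b → g a b * g a b)
              ≡ ∑₂ n g * ∑₂ n g
  ∑₂-square zero    g = refl
  ∑₂-square (suc n) g =
    trans (cong (λ z → 2 * (∑₃ n (λ b c d → k b * g′ c d + k c * g′ b d + k d * g′ b c)
                            + ∑₄ n (λ a b c d → g′ a b * g′ c d + g′ a c * g′ b d + g′ a d * g′ b c))
                       + 2 * (z + ∑₃ n (λ b c d → g′ b c * g′ b d + g′ b c * g′ c d + g′ b d * g′ c d))
                       + (∑[ x < n ] (k x * k x) + ∑₂ n (λ a b → g′ a b * g′ a b))) first)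
          (step (sum k) (∑₂ n g′) (∑₃ n λ b c d → k b * g′ c d + k c * g′ b d + k d * g′ b c)
                (∑₄ n λ a b c d → g′ a b * g′ c d + g′ a c * g′ b d + g′ a d * g′ b c)
                (∑₂ n λ c d → k c * k d) (∑₂ n λ c d → (k c + k d) * g′ c d)
                (∑₃ n λ b c d → g′ b c * g′ b d + g′ b c * g′ c d + g′ b d * g′ c d)
                (∑[ x < n ] (k x * k x)) (∑₂ n λ a b → g′ a b * g′ a b)
                (∑-*-∑₂ n k g′) (∑-square n k) (∑₂-square n g′))
    where
    open ≡-Reasoning
    k = λ x → g zero (suc x)
    g′ = λ x y → g (suc x) (suc y)
    first : ∑₂ n (λ c d → k c * k d + k c * g′ c d + k d * g′ c d)
            ≡ ∑₂ n (λ c d → k c * k d) + ∑₂ n (λ c d → (k c + k d) * g′ c d)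
    first = trans (∑₂-cong n λ c d → regroup (k c) (k d) (g′ c d)) (∑₂-distrib-+ n _ _)
      where
      regroup : ∀ x y z → x * y + x * z + y * z ≡ x * y + (x + y) * z
      regroup = solve-∀
    step : ∀ K E X D P H C K₂ Q → X + H ≡ K * E → 2 * P + K₂ ≡ K * K → 2 * D + 2 * C + Q ≡ E * E →
           2 * (X + D) + 2 * (P + H + C) + (K₂ + Q) ≡ (K + E) * (K + E)
    step K E X D P H C K₂ Q cross square ih = begin
      2 * (X + D) + 2 * (P + H + C) + (K₂ + Q)               ≡⟨ solve (X ∷ D ∷ P ∷ H ∷ C ∷ K₂ ∷ Q ∷ []) ⟩
      2 * (X + H) + (2 * P + K₂) + (2 * D + 2 * C + Q)       ≡⟨ cong₂ (λ a b → 2 * a + b + (2 * D + 2 * C + Q)) cross square ⟩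
      2 * (K * E) + K * K + (2 * D + 2 * C + Q)              ≡⟨ cong (2 * (K * E) + K * K +_) ih ⟩
      2 * (K * E) + K * K + E * E                            ≡⟨ solve (K ∷ E ∷ []) ⟩
      (K + E) * (K + E)                                      ∎

module FourVertexGraphs where

  open import Defs
  open import Data.Bool using (Bool; true; false)
  open import Data.Bool.ListAction using (and; or; any; all)
  open import Data.Nat using (ℕ; suc; _*_)
  open import Data.Nat.ListAction using (sum)
  open import Data.Fin using (Fin)
  open import Data.Fin.Patterns using (0F; 1F; 2F; 3F)
  open import Data.List using (List; []; _∷_; _++_; map; allFin)
  open import Data.List.Properties using (map-cong; ∷-injective)
  open import Data.List.Membership.Propositional using (_∈_)
  open import Data.List.Membership.Propositional.Properties using (∈-map⁺; ∈-++⁺ˡ; ∈-++⁺ʳ)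
  open import Data.List.Relation.Unary.Any using (here; there)
  open import Data.Vec using (Vec; []; _∷_)
  open import Data.Product using (_×_; _,_; proj₁; proj₂)
  open import Relation.Binary.PropositionalEquality
  open import Function using (_∘_)

  𝟙 : Bool → ℕ
  𝟙 true  = 1
  𝟙 false = 0

  Slot : Set
  Slot = Fin 4 × Fin 4

  slots : List Slot
  slots = (0F , 1F) ∷ (0F , 2F) ∷ (0F , 3F) ∷ (1F , 2F) ∷ (1F , 3F) ∷ (2F , 3F) ∷ []

  slot : Adj 4 → Slot → ℕ
  slot H (i , j) = 𝟙 (H i j)

  slotProduct : Adj 4 → Slot × Slot → ℕ
  slotProduct H (s , t) = slot H s * slot H t

  linearStat : List Slot → Adj 4 → ℕ
  linearStat S H = sum (map (slot H) S)

  quadraticStat : List (Slot × Slot) → Adj 4 → ℕ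
  quadraticStat M H = sum (map (slotProduct H) M)

  matchings : List (Slot × Slot)
  matchings = ((0F , 1F) , (2F , 3F)) ∷ ((0F , 2F) , (1F , 3F)) ∷ ((0F , 3F) , (1F , 2F)) ∷ []

  cherries : List (Slot × Slot)
  cherries = triangle 0F 1F 2F ++ triangle 0F 1F 3F ++ triangle 0F 2F 3F ++ triangle 1F 2F 3F
    where
    triangle : Fin 4 → Fin 4 → Fin 4 → List (Slot × Slot)
    triangle a b c = ((a , b) , (a , c)) ∷ ((a , b) , (b , c)) ∷ ((a , c) , (b , c)) ∷ []

  vertexCount edgeCount matchingCount cherryCount : Adj 4 → ℕ
  vertexCount _ = 1
  edgeCount     = linearStat slots
  matchingCount = quadraticStat matchings
  cherryCount   = quadraticStat cherries

  -- one edge set for each of the eleven isomorphism classes of graphs on four vertices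
  repEdgeSets : List (List Slot)
  repEdgeSets =
    ( []
    ∷ ((0F , 1F) ∷ [])
    ∷ ((0F , 1F) ∷ (0F , 2F) ∷ [])
    ∷ ((0F , 1F) ∷ (2F , 3F) ∷ [])
    ∷ ((0F , 1F) ∷ (0F , 2F) ∷ (1F , 2F) ∷ [])
    ∷ ((0F , 1F) ∷ (0F , 2F) ∷ (0F , 3F) ∷ [])
    ∷ ((0F , 1F) ∷ (0F , 2F) ∷ (1F , 3F) ∷ [])
    ∷ ((0F , 1F) ∷ (0F , 3F) ∷ (1F , 2F) ∷ (2F , 3F) ∷ [])
    ∷ ((0F , 1F) ∷ (0F , 2F) ∷ (0F , 3F) ∷ (1F , 2F) ∷ [])
    ∷ ((0F , 1F) ∷ (0F , 2F) ∷ (0F , 3F) ∷ (1F , 2F) ∷ (1F , 3F) ∷ [])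
    ∷ ((0F , 1F) ∷ (0F , 2F) ∷ (0F , 3F) ∷ (1F , 2F) ∷ (1F , 3F) ∷ (2F , 3F) ∷ [])
    ∷ [])

  reps : List (Adj 4)
  reps = map adjOf repEdgeSets

  permutations : List (Quad 4)
  permutations =
    (0F , 1F , 2F , 3F) ∷ (0F , 1F , 3F , 2F) ∷ (0F , 2F , 1F , 3F) ∷ (0F , 2F , 3F , 1F) ∷ (0F , 3F , 1F , 2F) ∷ (0F , 3F , 2F , 1F) ∷
    (1F , 0F , 2F , 3F) ∷ (1F , 0F , 3F , 2F) ∷ (1F , 2F , 0F , 3F) ∷ (1F , 2F , 3F , 0F) ∷ (1F , 3F , 0F , 2F) ∷ (1F , 3F , 2F , 0F) ∷
    (2F , 0F , 1F , 3F) ∷ (2F , 0F , 3F , 1F) ∷ (2F , 1F , 0F , 3F) ∷ (2F , 1F , 3F , 0F) ∷ (2F , 3F , 0F , 1F) ∷ (2F , 3F , 1F , 0F) ∷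
    (3F , 0F , 1F , 2F) ∷ (3F , 0F , 2F , 1F) ∷ (3F , 1F , 0F , 2F) ∷ (3F , 1F , 2F , 0F) ∷ (3F , 2F , 0F , 1F) ∷ (3F , 2F , 1F , 0F) ∷ []

  -- isIso4 with perms4 written out: class sums below are decided by evaluation, which is
  -- dominated by recomputing perms4 as a filter of 256 candidates.
  isIso4′ : Adj 4 → Adj 4 → Bool
  isIso4′ F H = any (λ σ → all (λ i → all (λ j → F (σ i) (σ j) ==ᵇ H i j) (allFin 4)) (allFin 4))
                    (map quadFun permutations)

  classSum : (Adj 4 → ℕ) → Adj 4 → ℕ
  classSum f H = sum (map (λ R → f R * 𝟙 (isIso4′ R H)) reps)

  fromSlotBits : Vec Bool 6 → Adj 4
  fromSlotBits (b01 ∷ b02 ∷ b03 ∷ b12 ∷ b13 ∷ b23 ∷ []) = H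
    where
    H : Adj 4
    H 0F 1F = b01
    H 0F 2F = b02
    H 0F 3F = b03
    H 1F 2F = b12
    H 1F 3F = b13
    H 2F 3F = b23
    H 1F 0F = b01
    H 2F 0F = b02
    H 3F 0F = b03
    H 2F 1F = b12
    H 3F 1F = b13
    H 3F 2F = b23
    H 0F 0F = false
    H 1F 1F = false
    H 2F 2F = false
    H 3F 3F = false

  bitVectors : ∀ k → List (Vec Bool k)
  bitVectors 0       = [] ∷ []
  bitVectors (suc k) = map (true ∷_) (bitVectors k) ++ map (false ∷_) (bitVectors k)

  ∈-bitVectors : ∀ {k} (v : Vec Bool k) → v ∈ bitVectors k
  ∈-bitVectors []          = here refl
  ∈-bitVectors (true ∷ v)  = ∈-++⁺ˡ (∈-map⁺ (true ∷_) (∈-bitVectors v))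
  ∈-bitVectors (false ∷ v) = ∈-++⁺ʳ (map (true ∷_) (bitVectors _)) (∈-map⁺ (false ∷_) (∈-bitVectors v))

  slotBits : Adj 4 → Vec Bool 6
  slotBits H = H 0F 1F ∷ H 0F 2F ∷ H 0F 3F ∷ H 1F 2F ∷ H 1F 3F ∷ H 2F 3F ∷ []

  fromSlotBits-slotBits : (H : SimpleGraph 4) → ∀ i j → SimpleGraph.adj H i j ≡ fromSlotBits (slotBits (SimpleGraph.adj H)) i j
  fromSlotBits-slotBits H = go
    where
    open SimpleGraph H renaming (sym to adj-sym)
    go : ∀ i j → adj i j ≡ fromSlotBits (slotBits adj) i j
    go 0F 0F = irrefl 0F
    go 0F 1F = refl
    go 0F 2F = refl
    go 0F 3F = refl
    go 1F 0F = adj-sym 1F 0F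
    go 1F 1F = irrefl 1F
    go 1F 2F = refl
    go 1F 3F = refl
    go 2F 0F = adj-sym 2F 0F
    go 2F 1F = adj-sym 2F 1F
    go 2F 2F = irrefl 2F
    go 2F 3F = refl
    go 3F 0F = adj-sym 3F 0F
    go 3F 1F = adj-sym 3F 1F
    go 3F 2F = adj-sym 3F 2F
    go 3F 3F = irrefl 3F

  isIso4≡isIso4′ : ∀ F H → isIso4 F H ≡ isIso4′ F H
  isIso4≡isIso4′ F H = refl

  isIso4′-congʳ : ∀ F {H H′ : Adj 4} → (∀ i j → H i j ≡ H′ i j) → isIso4′ F H ≡ isIso4′ F H′
  isIso4′-congʳ F H≗H′ = cong or (map-cong (λ σ → cong and (map-cong (λ i → cong and (map-cong (λ j →
    cong (F (σ i) (σ j) ==ᵇ_) (H≗H′ i j)) (allFin 4))) (allFin 4))) (map quadFun permutations))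

  classSum-congʳ : ∀ f {H H′ : Adj 4} → (∀ i j → H i j ≡ H′ i j) → classSum f H ≡ classSum f H′
  classSum-congʳ f H≗H′ = cong sum (map-cong (λ R → cong (λ b → f R * 𝟙 b) (isIso4′-congʳ R H≗H′)) reps)

  map-≡⇒≡ : ∀ {A B : Set} {f g : A → B} {xs x} → map f xs ≡ map g xs → x ∈ xs → f x ≡ g x
  map-≡⇒≡ {xs = _ ∷ _} eq (here refl) = proj₁ (∷-injective eq)
  map-≡⇒≡ {xs = _ ∷ _} eq (there x∈) = map-≡⇒≡ (proj₂ (∷-injective eq)) x∈

  IsClassFunction : (Adj 4 → ℕ) → Set
  IsClassFunction f = (H : SimpleGraph 4) → classSum f (SimpleGraph.adj H) ≡ f (SimpleGraph.adj H)

  isClassFunction : ∀ f → (∀ H → f H ≡ f (fromSlotBits (slotBits H))) →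
                    map (classSum f ∘ fromSlotBits) (bitVectors 6) ≡ map (f ∘ fromSlotBits) (bitVectors 6) →
                    IsClassFunction f
  isClassFunction f reads-slots check H = begin
    classSum f adj                          ≡⟨ classSum-congʳ f (fromSlotBits-slotBits H) ⟩
    classSum f (fromSlotBits (slotBits adj)) ≡⟨ map-≡⇒≡ {f = classSum f ∘ fromSlotBits} {f ∘ fromSlotBits} {bitVectors 6} check (∈-bitVectors (slotBits adj)) ⟩
    f (fromSlotBits (slotBits adj))          ≡⟨ reads-slots adj ⟨
    f adj                                    ∎
    where
    open SimpleGraph H using (adj)
    open ≡-Reasoning

  vertexCount-class : IsClassFunction vertexCount
  vertexCount-class = isClassFunction vertexCount (λ _ → refl) refl

  edgeCount-class : IsClassFunction edgeCount
  edgeCount-class = isClassFunction edgeCount (λ _ → refl) refl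

  matchingCount-class : IsClassFunction matchingCount
  matchingCount-class = isClassFunction matchingCount (λ _ → refl) refl

  cherryCount-class : IsClassFunction cherryCount
  cherryCount-class = isClassFunction cherryCount (λ _ → refl) refl

module Counting where

  open import Defs
  open IncreasingSums
  open FourVertexGraphs
  open import Data.Bool using (Bool; true; false; _∧_; if_then_else_)
  open import Data.Nat using (ℕ; zero; suc; _+_; _*_)
  open import Data.Nat.Properties using (+-*-semiring; +-commutativeSemigroup; *-zeroʳ; *-distribˡ-+)
  open import Algebra.Properties.CommutativeSemigroup +-commutativeSemigroup using () renaming (interchange to +-interchange)
  import Data.Nat.ListAction as List
  open import Data.Nat.ListAction.Properties using (sum-++)
  open import Data.Fin using (Fin; zero; suc)
  open import Data.List using (List; []; _∷_; map; concatMap; filterᵇ; allFin; tabulate; length)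
  open import Data.List.Properties using (map-++; map-cong; map-∘)
  open import Function using (_∘_; id)
  open import Data.Product using (_×_; _,_)
  open import Algebra.Properties.Semiring.Sum +-*-semiring using (sum; sum-syntax; sum-cong-≗; sum-replicate-zero)
  open import Relation.Binary.PropositionalEquality

  module _ {A : Set} where

    length-filterᵇ : ∀ (P : A → Bool) xs → length (filterᵇ P xs) ≡ List.sum (map (λ x → 𝟙 (P x)) xs)
    length-filterᵇ P []       = refl
    length-filterᵇ P (x ∷ xs) with P x
    ... | true  = cong suc (length-filterᵇ P xs)
    ... | false = length-filterᵇ P xs

    sum-map-filterᵇ : ∀ (F : A → ℕ) (P : A → Bool) xs →
                      List.sum (map F (filterᵇ P xs)) ≡ List.sum (map (λ x → if P x then F x else 0) xs)
    sum-map-filterᵇ F P []       = refl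
    sum-map-filterᵇ F P (x ∷ xs) with P x
    ... | true  = cong (F x +_) (sum-map-filterᵇ F P xs)
    ... | false = sum-map-filterᵇ F P xs

    sum-map-cong : ∀ {f g : A → ℕ} → (∀ x → f x ≡ g x) → ∀ xs → List.sum (map f xs) ≡ List.sum (map g xs)
    sum-map-cong f≗g xs = cong List.sum (map-cong f≗g xs)

    sum-map-+ : ∀ (f g : A → ℕ) xs → List.sum (map (λ x → f x + g x) xs) ≡ List.sum (map f xs) + List.sum (map g xs)
    sum-map-+ f g []       = refl
    sum-map-+ f g (x ∷ xs) = trans (cong (f x + g x +_) (sum-map-+ f g xs)) (+-interchange (f x) (g x) _ _)

    sum-map-*ˡ : ∀ c (f : A → ℕ) xs → List.sum (map (λ x → c * f x) xs) ≡ c * List.sum (map f xs)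
    sum-map-*ˡ c f []       = sym (*-zeroʳ c)
    sum-map-*ˡ c f (x ∷ xs) = trans (cong (c * f x +_) (sum-map-*ˡ c f xs)) (sym (*-distribˡ-+ c (f x) _))

    sum-map-one : ∀ xs → List.sum (map (λ (_ : A) → 1) xs) ≡ length xs
    sum-map-one []       = refl
    sum-map-one (x ∷ xs) = cong suc (sum-map-one xs)

    sum-map-zero : ∀ xs → List.sum (map (λ (_ : A) → 0) xs) ≡ 0
    sum-map-zero []       = refl
    sum-map-zero (x ∷ xs) = sum-map-zero xs

  module _ {A B : Set} where

    sum-map-concatMap : ∀ (F : B → ℕ) (g : A → List B) xs →
                        List.sum (map F (concatMap g xs)) ≡ List.sum (map (λ x → List.sum (map F (g x))) xs)
    sum-map-concatMap F g []       = refl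
    sum-map-concatMap F g (x ∷ xs) = begin
      List.sum (map F (g x Data.List.++ concatMap g xs))               ≡⟨ cong List.sum (map-++ F (g x) _) ⟩
      List.sum (map F (g x) Data.List.++ map F (concatMap g xs))       ≡⟨ sum-++ (map F (g x)) _ ⟩
      List.sum (map F (g x)) + List.sum (map F (concatMap g xs))       ≡⟨ cong (List.sum (map F (g x)) +_) (sum-map-concatMap F g xs) ⟩
      List.sum (map F (g x)) + List.sum (map (λ x → List.sum (map F (g x))) xs) ∎
      where open ≡-Reasoning

    sum-map-comm : ∀ (F : A → B → ℕ) xs ys →
                   List.sum (map (λ x → List.sum (map (F x) ys)) xs) ≡ List.sum (map (λ y → List.sum (map (λ x → F x y) xs)) ys)
    sum-map-comm F []       ys = sym (sum-map-zero ys)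
    sum-map-comm F (x ∷ xs) ys = trans (cong (List.sum (map (F x) ys) +_) (sum-map-comm F xs ys))
                                       (sym (sum-map-+ (F x) (λ y → List.sum (map (λ x → F x y) xs)) ys))

  sum-map-tabulate : ∀ {A : Set} {n} (g : Fin n → A) (f : A → ℕ) → List.sum (map f (tabulate g)) ≡ ∑[ i < n ] f (g i)
  sum-map-tabulate {n = zero}  g f = refl
  sum-map-tabulate {n = suc n} g f = cong (f (g zero) +_) (sum-map-tabulate (g ∘ suc) f)

  sum-map-allFin : ∀ {n} (f : Fin n → ℕ) → List.sum (map f (allFin n)) ≡ ∑[ i < n ] f i
  sum-map-allFin = sum-map-tabulate id

  sum-concatMap-allFin : ∀ {B : Set} {n} (F : B → ℕ) (g : Fin n → List B) →
                         List.sum (map F (concatMap g (allFin n))) ≡ ∑[ i < n ] List.sum (map F (g i))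
  sum-concatMap-allFin {n = n} F g = trans (sum-map-concatMap F g (allFin n)) (sum-map-allFin λ i → List.sum (map F (g i)))

  sum-map-map-allFin : ∀ {B : Set} {n} (F : B → ℕ) (g : Fin n → B) → List.sum (map F (map g (allFin n))) ≡ ∑[ i < n ] F (g i)
  sum-map-map-allFin {n = n} F g = trans (cong List.sum (sym (map-∘ (allFin n)))) (sum-map-allFin (F ∘ g))

  ∑-if : ∀ {n} b (f : Fin n → ℕ) → ∑[ i < n ] (if b then f i else 0) ≡ (if b then sum f else 0)
  ∑-if     true  f = refl
  ∑-if {n} false f = sum-replicate-zero n

  if-∧ : ∀ x y {m : ℕ} → (if x ∧ y then m else 0) ≡ (if x then (if y then m else 0) else 0)
  if-∧ true  y = refl
  if-∧ false y = refl

  sum-pairs : ∀ n (F : Fin n × Fin n → ℕ) → List.sum (map F (pairs n)) ≡ ∑₂ n (λ i j → F (i , j))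
  sum-pairs n F =
    trans (sum-map-filterᵇ F _ (concatMap row (allFin n)))
    (trans (sum-concatMap-allFin F< row) (sum-cong-≗ λ i → sum-map-map-allFin F< (λ j → (i , j))))
    where
    row : Fin n → List (Fin n × Fin n)
    row i = map (λ j → (i , j)) (allFin n)
    F< : Fin n × Fin n → ℕ
    F< (i , j) = if i <ᶠ j then F (i , j) else 0

  sum-allQuads : ∀ n (F : Quad n → ℕ) →
                 List.sum (map F (allQuads n)) ≡ ∑[ a < n ] ∑[ b < n ] ∑[ c < n ] ∑[ d < n ] F (a , b , c , d)
  sum-allQuads n F =
    trans (sum-concatMap-allFin F quads₃) (sum-cong-≗ λ a →
    trans (sum-concatMap-allFin F (quads₂ a)) (sum-cong-≗ λ b →
    trans (sum-concatMap-allFin F (quads₁ a b)) (sum-cong-≗ λ c →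
    sum-map-map-allFin F (λ d → (a , b , c , d)))))
    where
    quads₁ : Fin n → Fin n → Fin n → List (Quad n)
    quads₁ a b c = map (λ d → (a , b , c , d)) (allFin n)
    quads₂ : Fin n → Fin n → List (Quad n)
    quads₂ a b = concatMap (quads₁ a b) (allFin n)
    quads₃ : Fin n → List (Quad n)
    quads₃ a = concatMap (quads₂ a) (allFin n)

  sum-fourSets : ∀ n (F : Quad n → ℕ) → List.sum (map F (fourSets n)) ≡ ∑₄ n (λ a b c d → F (a , b , c , d))
  sum-fourSets n F =
    trans (sum-map-filterᵇ F increasing (allQuads n))
    (trans (sum-allQuads n _)
           (sum-cong-≗ λ a → sum-cong-≗ λ b → trans (sum-cong-≗ (nested a b)) (∑-if (a <ᶠ b) (inner a b))))
    where
    inner : Fin n → Fin n → Fin n → ℕ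
    inner a b c = if b <ᶠ c then ∑> c (λ d → F (a , b , c , d)) else 0
    nested : ∀ a b c → ∑[ d < n ] (if increasing (a , b , c , d) then F (a , b , c , d) else 0)
                       ≡ (if a <ᶠ b then inner a b c else 0)
    nested a b c =
      trans (sum-cong-≗ λ d → trans (if-∧ (a <ᶠ b) ((b <ᶠ c) ∧ (c <ᶠ d)))
                                    (cong (λ m → if a <ᶠ b then m else 0) (if-∧ (b <ᶠ c) (c <ᶠ d))))
      (trans (∑-if (a <ᶠ b) (λ d → if b <ᶠ c then (if c <ᶠ d then F (a , b , c , d) else 0) else 0))
             (cong (λ m → if a <ᶠ b then m else 0) (∑-if (b <ᶠ c) (λ d → if c <ᶠ d then F (a , b , c , d) else 0))))

  weightedCount : ∀ {n} → (Adj 4 → ℕ) → Adj n → ℕ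
  weightedCount f G = List.sum (map (λ R → f R * N R G) reps)

  weightedCount-classSum : ∀ {n} f (G : Adj n) →
    weightedCount f G ≡ List.sum (map (λ q → classSum f (induced G (quadFun q))) (fourSets n))
  weightedCount-classSum {n} f G = begin
    List.sum (map (λ R → f R * N R G) reps)
      ≡⟨ sum-map-cong (λ R → trans (cong (f R *_) (length-filterᵇ _ (fourSets n)))
                                   (sym (sum-map-*ˡ (f R) (λ q → 𝟙 (isIso4 R (G[ q ]))) (fourSets n)))) reps ⟩
    List.sum (map (λ R → List.sum (map (λ q → f R * 𝟙 (isIso4 R (G[ q ]))) (fourSets n))) reps)
      ≡⟨ sum-map-comm (λ R q → f R * 𝟙 (isIso4 R (G[ q ]))) reps (fourSets n) ⟩
    List.sum (map (λ q → List.sum (map (λ R → f R * 𝟙 (isIso4 R (G[ q ]))) reps)) (fourSets n))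
      ≡⟨ sum-map-cong (λ q → sum-map-cong (λ R → cong (λ b → f R * 𝟙 b) (isIso4≡isIso4′ R (G[ q ]))) reps) (fourSets n) ⟩
    List.sum (map (λ q → classSum f (G[ q ])) (fourSets n)) ∎
    where
    open ≡-Reasoning
    G[_] : Quad n → Adj 4
    G[ q ] = induced G (quadFun q)

  induced-simple : ∀ {n} → SimpleGraph n → (Fin 4 → Fin n) → SimpleGraph 4
  induced-simple G v = record
    { adj    = induced adj v
    ; sym    = λ i j → SimpleGraph.sym G (v i) (v j)
    ; irrefl = λ i → SimpleGraph.irrefl G (v i)
    }
    where open SimpleGraph G using (adj)

  weightedCount-fourSets : ∀ {n} f → IsClassFunction f → (G : SimpleGraph n) →
    weightedCount f (SimpleGraph.adj G) ≡ List.sum (map (λ q → f (induced (SimpleGraph.adj G) (quadFun q))) (fourSets n))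
  weightedCount-fourSets {n} f class G =
    trans (weightedCount-classSum f (SimpleGraph.adj G))
          (sum-map-cong (λ q → class (induced-simple G (quadFun q))) (fourSets n))

module Rationals where

  open import Defs
  open import Data.Rational.Solver using (module +-*-Solver)
  open +-*-Solver using (solve; _:+_; _:*_; _:-_; :-_; _:=_)
  open import Data.Bool using (T)
  open import Data.Bool.Properties using (T-∧)
  open import Data.Bool.ListAction using (all)
  open import Function using (Equivalence)
  open import Data.Nat as ℕ using (ℕ; suc)
  import Data.Nat.Properties as ℕP
  import Data.Nat.ListAction as List
  import Data.Integer as ℤ
  import Data.Integer.Properties as ℤP
  open import Data.Nat.Coprimality using (1-coprimeTo) renaming (sym to coprime-sym)
  open import Data.Product using (_,_)
  open import Data.List using (List; []; _∷_; map; length; _++_)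
  open import Data.List.Properties using (map-cong)
  open import Data.List.Relation.Unary.All using (All; []; _∷_)
  open import Data.Rational as ℚ using (ℚ; 0ℚ; 1ℚ; _+_; _*_; _-_; -_; _≤_; _<_; _≤ᵇ_; mkℚ; _/_)
  import Data.Rational.Properties as ℚP
  open import Data.Sum using (inj₁; inj₂)
  open import Relation.Binary.PropositionalEquality

  ℕtoℚ≡mkℚ : ∀ k → ℕtoℚ k ≡ mkℚ (ℤ.+ k) 0 (coprime-sym (1-coprimeTo k))
  ℕtoℚ≡mkℚ k = ℚP.normalize-coprime (coprime-sym (1-coprimeTo k))

  ℕtoℚ-+ : ∀ a b → ℕtoℚ (a ℕ.+ b) ≡ ℕtoℚ a + ℕtoℚ b
  ℕtoℚ-+ a b = begin
    (ℤ.+ (a ℕ.+ b)) / 1                        ≡⟨ cong (λ z → (ℤ.+ z) / 1) (cong₂ ℕ._+_ (sym (ℕP.*-identityʳ a)) (sym (ℕP.*-identityʳ b))) ⟩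
    (ℤ.+ (a ℕ.* 1 ℕ.+ b ℕ.* 1)) / 1            ≡⟨ cong (_/ 1) (sym (ℤP.pos-+ (a ℕ.* 1) (b ℕ.* 1))) ⟩
    (ℤ.+ (a ℕ.* 1) ℤ.+ ℤ.+ (b ℕ.* 1)) / 1      ≡⟨ cong₂ (λ x y → (x ℤ.+ y) / 1) (ℤP.pos-* a 1) (ℤP.pos-* b 1) ⟩
    (ℤ.+ a ℤ.* ℤ.+ 1 ℤ.+ ℤ.+ b ℤ.* ℤ.+ 1) / 1  ≡⟨ sym (cong₂ _+_ (ℕtoℚ≡mkℚ a) (ℕtoℚ≡mkℚ b)) ⟩
    ℕtoℚ a + ℕtoℚ b                            ∎
    where open ≡-Reasoning

  ℕtoℚ-* : ∀ a b → ℕtoℚ (a ℕ.* b) ≡ ℕtoℚ a * ℕtoℚ b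
  ℕtoℚ-* a b = trans (cong (_/ 1) (ℤP.pos-* a b)) (sym (cong₂ _*_ (ℕtoℚ≡mkℚ a) (ℕtoℚ≡mkℚ b)))

  module _ {A : Set} where

    sumℚ-map-cong : ∀ {f g : A → ℚ} → (∀ x → f x ≡ g x) → ∀ xs → sumℚ (map f xs) ≡ sumℚ (map g xs)
    sumℚ-map-cong f≗g xs = cong sumℚ (map-cong f≗g xs)

    sumℚ-map-cong-All : ∀ {f g : A → ℚ} {xs} → All (λ x → f x ≡ g x) xs → sumℚ (map f xs) ≡ sumℚ (map g xs)
    sumℚ-map-cong-All []         = refl
    sumℚ-map-cong-All (e ∷ es) = cong₂ _+_ e (sumℚ-map-cong-All es)

    sumℚ-map-- : ∀ (f g : A → ℚ) xs → sumℚ (map (λ x → f x - g x) xs) ≡ sumℚ (map f xs) - sumℚ (map g xs)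
    sumℚ-map-- f g []       = refl
    sumℚ-map-- f g (x ∷ xs) = trans (cong ((f x - g x) +_) (sumℚ-map-- f g xs)) (regroup (f x) (g x) _ _)
      where
      regroup : ∀ a b c d → (a - b) + (c - d) ≡ (a + c) - (b + d)
      regroup = solve 4 (λ a b c d → (a :- b) :+ (c :- d) := (a :+ c) :- (b :+ d)) refl

    sumℚ-map-*ˡ : ∀ c (f : A → ℚ) xs → sumℚ (map (λ x → c * f x) xs) ≡ c * sumℚ (map f xs)
    sumℚ-map-*ˡ c f []       = sym (ℚP.*-zeroʳ c)
    sumℚ-map-*ˡ c f (x ∷ xs) = trans (cong ((c * f x) +_) (sumℚ-map-*ˡ c f xs)) (sym (ℚP.*-distribˡ-+ c (f x) _))

    sumℚ-map-const : ∀ c (xs : List A) → sumℚ (map (λ _ → c) xs) ≡ ℕtoℚ (length xs) * c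
    sumℚ-map-const c []       = sym (ℚP.*-zeroˡ c)
    sumℚ-map-const c (x ∷ xs) = begin
      c + sumℚ (map (λ _ → c) xs)       ≡⟨ cong (c +_) (sumℚ-map-const c xs) ⟩
      c + ℕtoℚ (length xs) * c          ≡⟨ cong (_+ ℕtoℚ (length xs) * c) (sym (ℚP.*-identityˡ c)) ⟩
      1ℚ * c + ℕtoℚ (length xs) * c     ≡⟨ sym (ℚP.*-distribʳ-+ c 1ℚ (ℕtoℚ (length xs))) ⟩
      (1ℚ + ℕtoℚ (length xs)) * c       ≡⟨ cong (_* c) (sym (ℕtoℚ-+ 1 (length xs))) ⟩
      ℕtoℚ (suc (length xs)) * c        ∎
      where open ≡-Reasoning

    ℕtoℚ-sum : ∀ (f : A → ℕ) xs → ℕtoℚ (List.sum (map f xs)) ≡ sumℚ (map (λ x → ℕtoℚ (f x)) xs)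
    ℕtoℚ-sum f []       = refl
    ℕtoℚ-sum f (x ∷ xs) = trans (ℕtoℚ-+ (f x) _) (cong (ℕtoℚ (f x) +_) (ℕtoℚ-sum f xs))

  sumℚ-++ : ∀ (xs ys : List ℚ) → sumℚ (xs ++ ys) ≡ sumℚ xs + sumℚ ys
  sumℚ-++ []       ys = sym (ℚP.+-identityˡ (sumℚ ys))
  sumℚ-++ (x ∷ xs) ys = trans (cong (x +_) (sumℚ-++ xs ys)) (sym (ℚP.+-assoc x (sumℚ xs) (sumℚ ys)))

  0≤ℕtoℚ : ∀ k → 0ℚ ≤ ℕtoℚ k
  0≤ℕtoℚ k = ℚP.nonNegative⁻¹ (ℕtoℚ k) {{ℚP.normalize-nonNeg k 1}}

  ℕtoℚ-*₃ : ∀ a b c → ℕtoℚ (a ℕ.* b ℕ.* c) ≡ ℕtoℚ a * ℕtoℚ b * ℕtoℚ c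
  ℕtoℚ-*₃ a b c = trans (ℕtoℚ-* (a ℕ.* b) c) (cong (_* ℕtoℚ c) (ℕtoℚ-* a b))

  cast-≡ : ∀ {a b} {x y : ℚ} → ℕtoℚ a ≡ x → ℕtoℚ b ≡ y → a ≡ b → x ≡ y
  cast-≡ a≡x b≡y a≡b = trans (sym a≡x) (trans (cong ℕtoℚ a≡b) b≡y)

  _÷_ : ℕ → (d : ℕ) → .{{ℕ.NonZero d}} → ℚ
  a ÷ d = (ℤ.+ a) / d

  0≤-+ : ∀ {x y} → 0ℚ ≤ x → 0ℚ ≤ y → 0ℚ ≤ x + y
  0≤-+ = ℚP.+-mono-≤

  0≤-* : ∀ {x y} → 0ℚ ≤ x → 0ℚ ≤ y → 0ℚ ≤ x * y
  0≤-* {x} {y} 0≤x 0≤y = ℚP.nonNegative⁻¹ (x * y) {{ℚP.nonNeg*nonNeg⇒nonNeg x {{ℚ.nonNegative 0≤x}} y {{ℚ.nonNegative 0≤y}}}}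

  0≤-const : ∀ c → T (0ℚ ≤ᵇ c) → 0ℚ ≤ c
  0≤-const c = ℚP.≤ᵇ⇒≤

  0≤-≡ : ∀ {x y} → x ≡ y → 0ℚ ≤ x → 0ℚ ≤ y
  0≤-≡ refl 0≤x = 0≤x

  ≤⇒0≤- : ∀ {a b} → a ≤ b → 0ℚ ≤ b - a
  ≤⇒0≤- {a} {b} a≤b = subst (_≤ b - a) (ℚP.+-inverseʳ a) (ℚP.+-monoˡ-≤ (- a) a≤b)

  0≤-⇒≤ : ∀ {a b} → 0ℚ ≤ b - a → a ≤ b
  0≤-⇒≤ {a} {b} 0≤b-a = subst₂ _≤_ (ℚP.+-identityʳ a) (a+[b-a] a b) (ℚP.+-monoʳ-≤ a 0≤b-a)
    where
    a+[b-a] : ∀ a b → a + (b - a) ≡ b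
    a+[b-a] = solve 2 (λ a b → a :+ (b :- a) := b) refl

  0≤-neg : ∀ {x} → x ≤ 0ℚ → 0ℚ ≤ - x
  0≤-neg = ℚP.neg-antimono-≤

  0≤-square : ∀ x → 0ℚ ≤ x * x
  0≤-square x with ℚP.≤-total 0ℚ x
  ... | inj₁ 0≤x = 0≤-* 0≤x 0≤x
  ... | inj₂ x≤0 = 0≤-≡ (neg*neg x) (0≤-* (0≤-neg x≤0) (0≤-neg x≤0))
    where
    neg*neg : ∀ x → (- x) * (- x) ≡ x * x
    neg*neg = solve 1 (λ x → (:- x) :* (:- x) := x :* x) refl

  0≤-cancelˡ : ∀ c {x} → 0ℚ < c → 0ℚ ≤ c * x → 0ℚ ≤ x
  0≤-cancelˡ c {x} 0<c 0≤cx = ℚP.*-cancelˡ-≤-pos c {{ℚ.positive 0<c}} (subst (_≤ c * x) (sym (ℚP.*-zeroʳ c)) 0≤cx)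

  all-≤ᵇ : ∀ {A : Set} (w : A → ℚ) c xs → T (all (λ x → w x ≤ᵇ c) xs) → All (λ x → w x ≤ c) xs
  all-≤ᵇ w c []       _ = []
  all-≤ᵇ w c (x ∷ xs) t = let t₁ , t₂ = Equivalence.to (T-∧ {w x ≤ᵇ c}) t in ℚP.≤ᵇ⇒≤ t₁ ∷ all-≤ᵇ w c xs t₂

module RandomSublists where

  open import Defs
  open FourVertexGraphs using (𝟙)
  open Rationals
  open import Data.Bool using (Bool; true; false; _∧_)
  open import Data.Bool.ListAction using (any)
  open import Data.Nat as ℕ using (ℕ; _∸_; z≤n; s≤s)
  import Data.Nat.Properties as ℕP
  open import Data.List using (List; []; _∷_; map; filterᵇ; length; _++_)
  open import Data.List.Properties using (map-++; map-∘)
  open import Data.List.Relation.Unary.All as All using (All; []; _∷_)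
  import Data.List.Relation.Unary.All.Properties as AllP
  open import Data.Rational using (ℚ; 0ℚ; 1ℚ; _+_; _*_; _-_)
  import Data.Rational.Properties as ℚP
  open import Data.Rational.Solver using (module +-*-Solver)
  open +-*-Solver using (solve; _:+_; _:*_; _:-_; con; _:=_)
  open import Relation.Binary.PropositionalEquality

  subsets-length : ∀ {A : Set} (L : List A) → All (λ E → length E ℕ.≤ length L) (subsets L)
  subsets-length []      = z≤n ∷ []
  subsets-length (x ∷ L) =
    AllP.++⁺ (All.map ℕP.m≤n⇒m≤1+n (subsets-length L)) (AllP.map⁺ (All.map s≤s (subsets-length L)))

  module _ (p : ℚ) where

    -- 𝔼 p L g: the expectation of g E when E keeps each element of L independently with probability p.
    𝔼 : ∀ {A : Set} → List A → (List A → ℚ) → ℚ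
    𝔼 []      g = g []
    𝔼 (x ∷ L) g = (1ℚ - p) * 𝔼 L g + p * 𝔼 L (λ E → g (x ∷ E))

    sum-subsets≡𝔼 : ∀ {A : Set} (L : List A) g →
      sumℚ (map (λ E → ((p ^ℚ length E) * ((1ℚ - p) ^ℚ (length L ∸ length E))) * g E) (subsets L)) ≡ 𝔼 L g
    sum-subsets≡𝔼 []      g = trans (ℚP.+-identityʳ _) (ℚP.*-identityˡ (g []))
    sum-subsets≡𝔼 (x ∷ L) g = begin
      sumℚ (map (weight (x ∷ L) g) (subsets L ++ map (x ∷_) (subsets L)))
        ≡⟨ cong sumℚ (map-++ (weight (x ∷ L) g) (subsets L) _) ⟩
      sumℚ (map (weight (x ∷ L) g) (subsets L) ++ map (weight (x ∷ L) g) (map (x ∷_) (subsets L)))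
        ≡⟨ sumℚ-++ (map (weight (x ∷ L) g) (subsets L)) _ ⟩
      sumℚ (map (weight (x ∷ L) g) (subsets L)) + sumℚ (map (weight (x ∷ L) g) (map (x ∷_) (subsets L)))
        ≡⟨ cong₂ _+_ without-x (trans (cong sumℚ (sym (map-∘ (subsets L)))) with-x) ⟩
      (1ℚ - p) * sumℚ (map (weight L g) (subsets L)) + p * sumℚ (map (weight L (λ E → g (x ∷ E))) (subsets L))
        ≡⟨ cong₂ (λ a b → (1ℚ - p) * a + p * b) (sum-subsets≡𝔼 L g) (sum-subsets≡𝔼 L (λ E → g (x ∷ E))) ⟩
      (1ℚ - p) * 𝔼 L g + p * 𝔼 L (λ E → g (x ∷ E)) ∎
      where
      open ≡-Reasoning
      factor-middle : ∀ a b c d → a * (b * c) * d ≡ b * (a * c * d)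
      factor-middle = solve 4 (λ a b c d → a :* (b :* c) :* d := b :* (a :* c :* d)) refl
      factor-front : ∀ a b c d → b * a * c * d ≡ b * (a * c * d)
      factor-front = solve 4 (λ a b c d → b :* a :* c :* d := b :* (a :* c :* d)) refl
      weight : List _ → (List _ → ℚ) → List _ → ℚ
      weight L g E = ((p ^ℚ length E) * ((1ℚ - p) ^ℚ (length L ∸ length E))) * g E
      without-x : sumℚ (map (weight (x ∷ L) g) (subsets L)) ≡ (1ℚ - p) * sumℚ (map (weight L g) (subsets L))
      without-x = trans (sumℚ-map-cong-All (All.map (λ {E} |E|≤|L| →
                    trans (cong (λ k → ((p ^ℚ length E) * ((1ℚ - p) ^ℚ k)) * g E) (ℕP.+-∸-assoc 1 |E|≤|L|))
                          (factor-middle (p ^ℚ length E) (1ℚ - p) ((1ℚ - p) ^ℚ (length L ∸ length E)) (g E)))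
                    (subsets-length L)))
                    (sumℚ-map-*ˡ (1ℚ - p) (weight L g) (subsets L))
      with-x : sumℚ (map (λ E → weight (x ∷ L) g (x ∷ E)) (subsets L)) ≡ p * sumℚ (map (weight L (λ E → g (x ∷ E))) (subsets L))
      with-x = trans (sumℚ-map-cong (λ E → factor-front (p ^ℚ length E) p ((1ℚ - p) ^ℚ (length L ∸ length E)) (g (x ∷ E))) (subsets L))
                     (sumℚ-map-*ˡ p (weight L (λ E → g (x ∷ E))) (subsets L))

    private
      mix-const : ∀ p c → (1ℚ - p) * c + p * c ≡ c
      mix-const = solve 2 (λ p c → (con 1ℚ :- p) :* c :+ p :* c := c) refl
      mix-+ : ∀ q p a b c d → q * (a + b) + p * (c + d) ≡ (q * a + p * c) + (q * b + p * d)
      mix-+ = solve 6 (λ q p a b c d → q :* (a :+ b) :+ p :* (c :+ d) := (q :* a :+ p :* c) :+ (q :* b :+ p :* d)) refl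
      mix-*ˡ : ∀ q p c a b → q * (c * a) + p * (c * b) ≡ c * (q * a + p * b)
      mix-*ˡ = solve 5 (λ q p c a b → q :* (c :* a) :+ p :* (c :* b) := c :* (q :* a :+ p :* b)) refl
      mix-0 : ∀ p c → (1ℚ - p) * 0ℚ + p * c ≡ p * c
      mix-0 = solve 2 (λ p c → (con 1ℚ :- p) :* con 0ℚ :+ p :* c := p :* c) refl

    module _ {A : Set} where

      𝔼-cong : ∀ (L : List A) {g g′ : List A → ℚ} → (∀ E → g E ≡ g′ E) → 𝔼 L g ≡ 𝔼 L g′
      𝔼-cong []      e = e []
      𝔼-cong (x ∷ L) e = cong₂ (λ a b → (1ℚ - p) * a + p * b) (𝔼-cong L e) (𝔼-cong L (λ E → e (x ∷ E)))

      𝔼-cong-All : ∀ {P : A → Set} {L} → All P L → {g g′ : List A → ℚ} →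
                   (∀ E → All P E → g E ≡ g′ E) → 𝔼 L g ≡ 𝔼 L g′
      𝔼-cong-All []         e = e [] []
      𝔼-cong-All (px ∷ pxs) e =
        cong₂ (λ a b → (1ℚ - p) * a + p * b) (𝔼-cong-All pxs e) (𝔼-cong-All pxs λ E pE → e (_ ∷ E) (px ∷ pE))

      𝔼-const : ∀ (L : List A) c → 𝔼 L (λ _ → c) ≡ c
      𝔼-const []      c = refl
      𝔼-const (x ∷ L) c = trans (cong₂ (λ a b → (1ℚ - p) * a + p * b) (𝔼-const L c) (𝔼-const L c)) (mix-const p c)

      𝔼-+ : ∀ (L : List A) g h → 𝔼 L (λ E → g E + h E) ≡ 𝔼 L g + 𝔼 L h
      𝔼-+ []      g h = refl
      𝔼-+ (x ∷ L) g h =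
        trans (cong₂ (λ a b → (1ℚ - p) * a + p * b) (𝔼-+ L g h) (𝔼-+ L (λ E → g (x ∷ E)) (λ E → h (x ∷ E))))
              (mix-+ (1ℚ - p) p _ _ _ _)

      𝔼-*ˡ : ∀ (L : List A) c g → 𝔼 L (λ E → c * g E) ≡ c * 𝔼 L g
      𝔼-*ˡ []      c g = refl
      𝔼-*ˡ (x ∷ L) c g =
        trans (cong₂ (λ a b → (1ℚ - p) * a + p * b) (𝔼-*ˡ L c g) (𝔼-*ˡ L c (λ E → g (x ∷ E))))
              (mix-*ˡ (1ℚ - p) p c _ _)

      𝔼-sum : ∀ {B : Set} (L : List A) (f : B → List A → ℚ) ys →
              𝔼 L (λ E → sumℚ (map (λ y → f y E) ys)) ≡ sumℚ (map (λ y → 𝔼 L (f y)) ys)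
      𝔼-sum L f []       = 𝔼-const L 0ℚ
      𝔼-sum L f (y ∷ ys) = trans (𝔼-+ L (f y) _) (cong (𝔼 L (f y) +_) (𝔼-sum L f ys))

      𝔼-absent : ∀ (μ : A → Bool) L → length (filterᵇ μ L) ≡ 0 → (g : Bool → List A → ℚ) →
                 𝔼 L (λ E → g (any μ E) E) ≡ 𝔼 L (g false)
      𝔼-absent μ []      _     g = refl
      𝔼-absent μ (x ∷ L) count g with μ x
      ... | false = cong₂ (λ a b → (1ℚ - p) * a + p * b) (𝔼-absent μ L count g) (𝔼-absent μ L count (λ b E → g b (x ∷ E)))

      𝔼-indicator : ∀ (μ : A → Bool) L → length (filterᵇ μ L) ≡ 1 → 𝔼 L (λ E → ℕtoℚ (𝟙 (any μ E))) ≡ p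
      𝔼-indicator μ (x ∷ L) count with μ x
      ... | true  = trans (cong₂ (λ a b → (1ℚ - p) * a + p * b)
                                 (trans (𝔼-absent μ L (ℕP.suc-injective count) (λ b _ → ℕtoℚ (𝟙 b))) (𝔼-const L 0ℚ))
                                 (𝔼-const L 1ℚ))
                          (trans (mix-0 p 1ℚ) (ℚP.*-identityʳ p))
      ... | false = trans (cong₂ (λ a b → (1ℚ - p) * a + p * b) (𝔼-indicator μ L count) (𝔼-indicator μ L count))
                          (mix-const p p)

      𝔼-indicator² : ∀ (μ ν : A → Bool) L → length (filterᵇ μ L) ≡ 1 → length (filterᵇ ν L) ≡ 1 →
                     All (λ x → μ x ∧ ν x ≡ false) L → 𝔼 L (λ E → ℕtoℚ (𝟙 (any μ E) ℕ.* 𝟙 (any ν E))) ≡ p * p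
      𝔼-indicator² μ ν (x ∷ L) countμ countν (disjoint ∷ disjoints) with μ x | ν x
      ... | true  | false = trans (cong₂ (λ a b → (1ℚ - p) * a + p * b)
                                         (trans (𝔼-absent μ L (ℕP.suc-injective countμ) (λ b E → ℕtoℚ (𝟙 b ℕ.* 𝟙 (any ν E))))
                                                (𝔼-const L 0ℚ))
                                         (trans (𝔼-cong L λ E → cong ℕtoℚ (ℕP.*-identityˡ (𝟙 (any ν E))))
                                                (𝔼-indicator ν L countν)))
                                  (mix-0 p p)
      ... | false | true  = trans (cong₂ (λ a b → (1ℚ - p) * a + p * b)
                                         (trans (𝔼-absent ν L (ℕP.suc-injective countν) (λ b E → ℕtoℚ (𝟙 (any μ E) ℕ.* 𝟙 b)))
                                                (trans (𝔼-cong L λ E → cong ℕtoℚ (ℕP.*-zeroʳ (𝟙 (any μ E)))) (𝔼-const L 0ℚ)))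
                                         (trans (𝔼-cong L λ E → cong ℕtoℚ (ℕP.*-identityʳ (𝟙 (any μ E))))
                                                (𝔼-indicator μ L countμ)))
                                  (mix-0 p p)
      ... | false | false = trans (cong₂ (λ a b → (1ℚ - p) * a + p * b)
                                         (𝔼-indicator² μ ν L countμ countν disjoints)
                                         (𝔼-indicator² μ ν L countμ countν disjoints))
                                  (mix-const p (p * p))

module RandomGraph where

  open import Defs
  open IncreasingSums
  open FourVertexGraphs
  open Counting
  open Rationals
  open RandomSublists
  open import Data.Bool using (Bool; true; false; _∧_; _∨_; not; T; if_then_else_)
  open import Data.Bool.Properties using (T-∧; T-∨; T-not-≡; ∨-comm)
  open import Data.Bool.ListAction using (any; all; or)
  open import Data.Empty using (⊥-elim)
  open import Data.Nat as ℕ using (ℕ; suc; _<_)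
  import Data.Nat.Properties as ℕP
  import Data.Nat.ListAction as List
  open import Data.Fin using (Fin; zero; suc; toℕ)
  open import Data.Fin.Patterns using (0F; 1F; 2F; 3F)
  open import Data.List using (List; []; _∷_; map; filterᵇ; length; allFin; concatMap)
  open import Data.List.Properties using (map-cong)
  open import Data.List.Relation.Unary.All as All using (All; []; _∷_)
  open import Data.List.Relation.Unary.All.Properties using (all⁺; all-filter)
  open import Data.Product using (_×_; _,_; proj₁; proj₂)
  open import Data.Sum using (inj₁; inj₂)
  open import Data.Rational using (ℚ; _*_)
  open import Function using (_∘_; Equivalence)
  open import Relation.Nullary using (¬_)
  open import Relation.Binary.PropositionalEquality
  open import Relation.Binary.Definitions using (tri<; tri≈; tri>)
  open import Algebra.Properties.Semiring.Sum ℕP.+-*-semiring using (sum; sum-syntax; sum-cong-≗; sum-replicate-zero)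

  joins : ∀ {n} → Fin n → Fin n → Fin n × Fin n → Bool
  joins u v (a , b) = ((a =ᶠ u) ∧ (b =ᶠ v)) ∨ ((a =ᶠ v) ∧ (b =ᶠ u))

  adjOf≡any-joins : ∀ {n} (E : List (Fin n × Fin n)) u v → adjOf E u v ≡ any (joins u v) E
  adjOf≡any-joins []      u v = refl
  adjOf≡any-joins (e ∷ E) u v = cong (joins u v e ∨_) (adjOf≡any-joins E u v)

  T-=ᶠ : ∀ {n} {i j : Fin n} → T (i =ᶠ j) → toℕ i ≡ toℕ j
  T-=ᶠ {i = i} {j} = ℕP.≡ᵇ⇒≡ (toℕ i) (toℕ j)

  joins-ordered : ∀ {n} {u v i j : Fin n} → toℕ u < toℕ v → toℕ i < toℕ j →
                  T (joins u v (i , j)) → toℕ i ≡ toℕ u × toℕ j ≡ toℕ v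
  joins-ordered {u = u} {v} {i} {j} u<v i<j t with Equivalence.to (T-∨ {(i =ᶠ u) ∧ (j =ᶠ v)}) t
  ... | inj₁ t₁ = let i≡u , j≡v = Equivalence.to (T-∧ {i =ᶠ u}) t₁ in T-=ᶠ {i = i} i≡u , T-=ᶠ {i = j} j≡v
  ... | inj₂ t₂ = let i≡v , j≡u = Equivalence.to (T-∧ {i =ᶠ v}) t₂ in
                  ⊥-elim (ℕP.<-asym u<v (subst₂ _<_ (T-=ᶠ {i = i} i≡v) (T-=ᶠ {i = j} j≡u) i<j))

  T-ext : ∀ {x y} → (T x → T y) → (T y → T x) → x ≡ y
  T-ext {true}  {true}  _ _ = refl
  T-ext {true}  {false} f _ = ⊥-elim (f _)
  T-ext {false} {true}  _ g = ⊥-elim (g _)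
  T-ext {false} {false} _ _ = refl

  𝟙-∧ : ∀ x y → 𝟙 (x ∧ y) ≡ 𝟙 x ℕ.* 𝟙 y
  𝟙-∧ true  y = sym (ℕP.+-identityʳ (𝟙 y))
  𝟙-∧ false y = refl

  if-𝟙 : ∀ x y → (if x then 𝟙 y else 0) ≡ 𝟙 (x ∧ y)
  if-𝟙 true  y = refl
  if-𝟙 false y = refl

  ∑-indicator : ∀ {n} (v : Fin n) → ∑[ j < n ] 𝟙 (j =ᶠ v) ≡ 1
  ∑-indicator {suc n} zero    = cong suc (sum-replicate-zero n)
  ∑-indicator {suc n} (suc v) = ∑-indicator v

  joins-count : ∀ {n} {u v : Fin n} → toℕ u < toℕ v → length (filterᵇ (joins u v) (pairs n)) ≡ 1
  joins-count {n} {u} {v} u<v = begin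
    length (filterᵇ (joins u v) (pairs n))             ≡⟨ length-filterᵇ (joins u v) (pairs n) ⟩
    List.sum (map (λ e → 𝟙 (joins u v e)) (pairs n))   ≡⟨ sum-pairs n (λ e → 𝟙 (joins u v e)) ⟩
    ∑₂ n (λ i j → 𝟙 (joins u v (i , j)))               ≡⟨ sum-cong-≗ (λ i → sum-cong-≗ (λ j → summand i j)) ⟩
    ∑[ i < n ] ∑[ j < n ] (𝟙 (i =ᶠ u) ℕ.* 𝟙 (j =ᶠ v))  ≡⟨ sum-cong-≗ (λ i → ∑-distribˡ-* (𝟙 (i =ᶠ u)) (λ j → 𝟙 (j =ᶠ v))) ⟩
    ∑[ i < n ] (𝟙 (i =ᶠ u) ℕ.* ∑[ j < n ] 𝟙 (j =ᶠ v))  ≡⟨ sum-cong-≗ (λ i → cong (𝟙 (i =ᶠ u) ℕ.*_) (∑-indicator v)) ⟩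
    ∑[ i < n ] (𝟙 (i =ᶠ u) ℕ.* 1)                       ≡⟨ sum-cong-≗ (λ i → ℕP.*-identityʳ (𝟙 (i =ᶠ u))) ⟩
    ∑[ i < n ] 𝟙 (i =ᶠ u)                               ≡⟨ ∑-indicator u ⟩
    1                                                   ∎
    where
    open ≡-Reasoning
    summand : ∀ i j → (if i <ᶠ j then 𝟙 (joins u v (i , j)) else 0) ≡ 𝟙 (i =ᶠ u) ℕ.* 𝟙 (j =ᶠ v)
    summand i j = trans (if-𝟙 (i <ᶠ j) _) (trans (cong 𝟙 (T-ext ⇒ ⇐)) (𝟙-∧ (i =ᶠ u) (j =ᶠ v)))
      where
      ⇒ : T ((i <ᶠ j) ∧ joins u v (i , j)) → T ((i =ᶠ u) ∧ (j =ᶠ v))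
      ⇒ t = let i<j , ij = Equivalence.to (T-∧ {i <ᶠ j}) t
                i≡u , j≡v = joins-ordered u<v (ℕP.<ᵇ⇒< (toℕ i) (toℕ j) i<j) ij
            in Equivalence.from (T-∧ {i =ᶠ u}) (ℕP.≡⇒≡ᵇ (toℕ i) (toℕ u) i≡u , ℕP.≡⇒≡ᵇ (toℕ j) (toℕ v) j≡v)
      ⇐ : T ((i =ᶠ u) ∧ (j =ᶠ v)) → T ((i <ᶠ j) ∧ joins u v (i , j))
      ⇐ t = let i≡u , j≡v = Equivalence.to (T-∧ {i =ᶠ u}) t
            in Equivalence.from (T-∧ {i <ᶠ j}) (ℕP.<⇒<ᵇ (subst₂ _<_ (sym (T-=ᶠ {i = i} i≡u)) (sym (T-=ᶠ {i = j} j≡v)) u<v) ,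
                                                Equivalence.from (T-∨ {(i =ᶠ u) ∧ (j =ᶠ v)}) (inj₁ t))

  OrderedPair : ∀ {n} → Fin n × Fin n → Set
  OrderedPair (i , j) = T (i <ᶠ j)

  pairs-ordered : ∀ n → All OrderedPair (pairs n)
  pairs-ordered n = all-filter _ (concatMap (λ i → map (λ j → (i , j)) (allFin n)) (allFin n))

  joins-disjoint : ∀ {n} {u v u′ v′ : Fin n} → toℕ u < toℕ v → toℕ u′ < toℕ v′ →
                   ¬ (toℕ u ≡ toℕ u′ × toℕ v ≡ toℕ v′) → All (λ e → joins u v e ∧ joins u′ v′ e ≡ false) (pairs n)
  joins-disjoint {n} {u} {v} {u′} {v′} u<v u′<v′ distinct = All.map (λ {e} → disjoint-at e) (pairs-ordered n)
    where
    disjoint-at : ∀ e → OrderedPair e → joins u v e ∧ joins u′ v′ e ≡ false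
    disjoint-at (i , j) i<j = T-ext both (λ ())
      where
      both : T (joins u v (i , j) ∧ joins u′ v′ (i , j)) → T false
      both t = let t₁ , t₂ = Equivalence.to (T-∧ {joins u v (i , j)}) t
                   i≡u , j≡v = joins-ordered u<v (ℕP.<ᵇ⇒< (toℕ i) (toℕ j) i<j) t₁
                   i≡u′ , j≡v′ = joins-ordered u′<v′ (ℕP.<ᵇ⇒< (toℕ i) (toℕ j) i<j) t₂
               in distinct (trans (sym i≡u) i≡u′ , trans (sym j≡v) j≡v′)

  module _ (p : ℚ) {n : ℕ} where

    edge-expectation : ∀ {u v : Fin n} → toℕ u < toℕ v → 𝔼 p (pairs n) (λ E → ℕtoℚ (𝟙 (adjOf E u v))) ≡ p
    edge-expectation {u} {v} u<v =
      trans (𝔼-cong p (pairs n) λ E → cong (ℕtoℚ ∘ 𝟙) (adjOf≡any-joins E u v))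
            (𝔼-indicator p (joins u v) (pairs n) (joins-count u<v))

    edge-pair-expectation : ∀ {u v u′ v′ : Fin n} → toℕ u < toℕ v → toℕ u′ < toℕ v′ →
      ¬ (toℕ u ≡ toℕ u′ × toℕ v ≡ toℕ v′) →
      𝔼 p (pairs n) (λ E → ℕtoℚ (𝟙 (adjOf E u v) ℕ.* 𝟙 (adjOf E u′ v′))) ≡ p * p
    edge-pair-expectation {u} {v} {u′} {v′} u<v u′<v′ distinct =
      trans (𝔼-cong p (pairs n) λ E → cong₂ (λ x y → ℕtoℚ (𝟙 x ℕ.* 𝟙 y)) (adjOf≡any-joins E u v) (adjOf≡any-joins E u′ v′))
            (𝔼-indicator² p (joins u v) (joins u′ v′) (pairs n) (joins-count u<v) (joins-count u′<v′)
                          (joins-disjoint u<v u′<v′ distinct))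

  Increasing₄ : ∀ {n} → (Fin 4 → Fin n) → Set
  Increasing₄ w = ∀ i j → T (i <ᶠ j) → toℕ (w i) < toℕ (w j)

  quadFun-increasing : ∀ {n} (q : Quad n) → T (increasing q) → Increasing₄ (quadFun q)
  quadFun-increasing (a , b , c , d) t = go
    where
    a<b = ℕP.<ᵇ⇒< (toℕ a) (toℕ b) (proj₁ (Equivalence.to (T-∧ {a <ᶠ b}) t))
    b<c∧c<d = Equivalence.to (T-∧ {b <ᶠ c}) (proj₂ (Equivalence.to (T-∧ {a <ᶠ b}) t))
    b<c = ℕP.<ᵇ⇒< (toℕ b) (toℕ c) (proj₁ b<c∧c<d)
    c<d = ℕP.<ᵇ⇒< (toℕ c) (toℕ d) (proj₂ b<c∧c<d)
    go : Increasing₄ (quadFun (a , b , c , d))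
    go 0F 1F _ = a<b
    go 0F 2F _ = ℕP.<-trans a<b b<c
    go 0F 3F _ = ℕP.<-trans a<b (ℕP.<-trans b<c c<d)
    go 1F 2F _ = b<c
    go 1F 3F _ = ℕP.<-trans b<c c<d
    go 2F 3F _ = c<d
    go 0F 0F ()
    go 1F 0F ()
    go 1F 1F ()
    go 2F 0F ()
    go 2F 1F ()
    go 2F 2F ()
    go 3F 0F ()
    go 3F 1F ()
    go 3F 2F ()
    go 3F 3F ()

  Increasing₄-injective : ∀ {n} {w : Fin 4 → Fin n} → Increasing₄ w → ∀ i j → toℕ (w i) ≡ toℕ (w j) → toℕ i ≡ toℕ j
  Increasing₄-injective inc i j wi≡wj with ℕP.<-cmp (toℕ i) (toℕ j)
  ... | tri< i<j _ _ = ⊥-elim (ℕP.<⇒≢ (inc i j (ℕP.<⇒<ᵇ i<j)) wi≡wj)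
  ... | tri≈ _ i≡j _ = i≡j
  ... | tri> _ _ j<i = ⊥-elim (ℕP.<⇒≢ (inc j i (ℕP.<⇒<ᵇ j<i)) (sym wi≡wj))

  slotOrdered : Slot → Bool
  slotOrdered (i , j) = i <ᶠ j

  properSlotPair : Slot × Slot → Bool
  properSlotPair ((i , j) , (k , l)) = (i <ᶠ j) ∧ ((k <ᶠ l) ∧ not ((i =ᶠ k) ∧ (j =ᶠ l)))

  module _ (p : ℚ) {n : ℕ} {w : Fin 4 → Fin n} (inc : Increasing₄ w) where

    linearStat-expectation : ∀ S → T (all slotOrdered S) →
      𝔼 p (pairs n) (λ E → ℕtoℚ (linearStat S (induced (adjOf E) w))) ≡ ℕtoℚ (length S) * p
    linearStat-expectation S t = begin
      𝔼 p (pairs n) (λ E → ℕtoℚ (List.sum (map (slot (induced (adjOf E) w)) S)))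
        ≡⟨ 𝔼-cong p (pairs n) (λ E → ℕtoℚ-sum (slot (induced (adjOf E) w)) S) ⟩
      𝔼 p (pairs n) (λ E → sumℚ (map (λ s → ℕtoℚ (slot (induced (adjOf E) w) s)) S))
        ≡⟨ 𝔼-sum p (pairs n) (λ s E → ℕtoℚ (slot (induced (adjOf E) w) s)) S ⟩
      sumℚ (map (λ s → 𝔼 p (pairs n) (λ E → ℕtoℚ (slot (induced (adjOf E) w) s))) S)
        ≡⟨ sumℚ-map-cong-All (All.map (λ {s} → edge s) (all⁺ slotOrdered S t)) ⟩
      sumℚ (map (λ _ → p) S)
        ≡⟨ sumℚ-map-const p S ⟩
      ℕtoℚ (length S) * p ∎
      where
      open ≡-Reasoning
      edge : ∀ s → T (slotOrdered s) → 𝔼 p (pairs n) (λ E → ℕtoℚ (slot (induced (adjOf E) w) s)) ≡ p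
      edge (i , j) i<j = edge-expectation p (inc i j i<j)

    quadraticStat-expectation : ∀ M → T (all properSlotPair M) →
      𝔼 p (pairs n) (λ E → ℕtoℚ (quadraticStat M (induced (adjOf E) w))) ≡ ℕtoℚ (length M) * (p * p)
    quadraticStat-expectation M t = begin
      𝔼 p (pairs n) (λ E → ℕtoℚ (List.sum (map (slotProduct (induced (adjOf E) w)) M)))
        ≡⟨ 𝔼-cong p (pairs n) (λ E → ℕtoℚ-sum (slotProduct (induced (adjOf E) w)) M) ⟩
      𝔼 p (pairs n) (λ E → sumℚ (map (λ st → ℕtoℚ (slotProduct (induced (adjOf E) w) st)) M))
        ≡⟨ 𝔼-sum p (pairs n) (λ st E → ℕtoℚ (slotProduct (induced (adjOf E) w) st)) M ⟩
      sumℚ (map (λ st → 𝔼 p (pairs n) (λ E → ℕtoℚ (slotProduct (induced (adjOf E) w) st))) M)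
        ≡⟨ sumℚ-map-cong-All (All.map (λ {st} → edge-pair st) (all⁺ properSlotPair M t)) ⟩
      sumℚ (map (λ _ → p * p) M)
        ≡⟨ sumℚ-map-const (p * p) M ⟩
      ℕtoℚ (length M) * (p * p) ∎
      where
      open ≡-Reasoning
      edge-pair : ∀ st → T (properSlotPair st) → 𝔼 p (pairs n) (λ E → ℕtoℚ (slotProduct (induced (adjOf E) w) st)) ≡ p * p
      edge-pair ((i , j) , (k , l)) t =
        let i<j , rest = Equivalence.to (T-∧ {i <ᶠ j}) t
            k<l , ≢ = Equivalence.to (T-∧ {k <ᶠ l}) rest
            distinct : ¬ (toℕ (w i) ≡ toℕ (w k) × toℕ (w j) ≡ toℕ (w l))
            distinct = λ (wi≡wk , wj≡wl) →
              let i≡k = Increasing₄-injective inc i k wi≡wk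
                  j≡l = Increasing₄-injective inc j l wj≡wl
              in subst T (Equivalence.to (T-not-≡ {(i =ᶠ k) ∧ (j =ᶠ l)}) ≢)
                         (Equivalence.from (T-∧ {i =ᶠ k}) (ℕP.≡⇒≡ᵇ (toℕ i) (toℕ k) i≡k , ℕP.≡⇒≡ᵇ (toℕ j) (toℕ l) j≡l))
        in edge-pair-expectation p (inc i j i<j) (inc k l k<l) distinct

  any-false : ∀ {A : Set} (μ : A → Bool) {xs} → All (λ x → μ x ≡ false) xs → any μ xs ≡ false
  any-false μ []         = refl
  any-false μ (e ∷ es) = cong₂ _∨_ e (any-false μ es)

  edgeSetGraph : ∀ {n} (E : List (Fin n × Fin n)) → All OrderedPair E → SimpleGraph n
  edgeSetGraph E ordered-E = record
    { adj    = adjOf E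
    ; sym    = λ u v → trans (adjOf≡any-joins E u v)
                        (trans (cong or (map-cong (λ { (a , b) → ∨-comm ((a =ᶠ u) ∧ (b =ᶠ v)) _ }) E))
                               (sym (adjOf≡any-joins E v u)))
    ; irrefl = λ u → trans (adjOf≡any-joins E u u) (any-false (joins u u) (All.map (λ {e} → loop-free u e) ordered-E))
    }
    where
    loop-free : ∀ u e → OrderedPair e → joins u u e ≡ false
    loop-free u (a , b) a<b = T-ext (λ t → ⊥-elim (ℕP.<⇒≢ (ℕP.<ᵇ⇒< (toℕ a) (toℕ b) a<b) (a≡b t))) (λ ())
      where
      both-u : T ((a =ᶠ u) ∧ (b =ᶠ u)) → toℕ a ≡ toℕ b
      both-u t = let a≡u , b≡u = Equivalence.to (T-∧ {a =ᶠ u}) t in trans (T-=ᶠ {i = a} a≡u) (sym (T-=ᶠ {i = b} b≡u))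
      a≡b : T (joins u u (a , b)) → toℕ a ≡ toℕ b
      a≡b t with Equivalence.to (T-∨ {(a =ᶠ u) ∧ (b =ᶠ u)}) t
      ... | inj₁ t′ = both-u t′
      ... | inj₂ t′ = both-u t′

  module _ (p : ℚ) (n : ℕ) where

    expected-weightedCount : ∀ f → IsClassFunction f → (c : ℚ) →
      (∀ {w : Fin 4 → Fin n} → Increasing₄ w → 𝔼 p (pairs n) (λ E → ℕtoℚ (f (induced (adjOf E) w))) ≡ c) →
      sumℚ (map (λ R → ℕtoℚ (f R) * expectedN n p R) reps) ≡ ℕtoℚ (length (fourSets n)) * c
    expected-weightedCount f class c per-set = begin
      sumℚ (map (λ R → ℕtoℚ (f R) * expectedN n p R) reps)
        ≡⟨ sumℚ-map-cong (λ R → cong (ℕtoℚ (f R) *_) (sum-subsets≡𝔼 p (pairs n) (λ E → ℕtoℚ (N R (adjOf E))))) reps ⟩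
      sumℚ (map (λ R → ℕtoℚ (f R) * 𝔼 p (pairs n) (λ E → ℕtoℚ (N R (adjOf E)))) reps)
        ≡⟨ sumℚ-map-cong (λ R → sym (𝔼-*ˡ p (pairs n) (ℕtoℚ (f R)) (λ E → ℕtoℚ (N R (adjOf E))))) reps ⟩
      sumℚ (map (λ R → 𝔼 p (pairs n) (λ E → ℕtoℚ (f R) * ℕtoℚ (N R (adjOf E)))) reps)
        ≡⟨ sym (𝔼-sum p (pairs n) (λ R E → ℕtoℚ (f R) * ℕtoℚ (N R (adjOf E))) reps) ⟩
      𝔼 p (pairs n) (λ E → sumℚ (map (λ R → ℕtoℚ (f R) * ℕtoℚ (N R (adjOf E))) reps))
        ≡⟨ 𝔼-cong p (pairs n) (λ E → sym (cast E)) ⟩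
      𝔼 p (pairs n) (λ E → ℕtoℚ (weightedCount f (adjOf E)))
        ≡⟨ 𝔼-cong-All p (pairs-ordered n) (λ E ordered-E → cong ℕtoℚ (weightedCount-fourSets f class (edgeSetGraph E ordered-E))) ⟩
      𝔼 p (pairs n) (λ E → ℕtoℚ (List.sum (map (λ q → f (induced (adjOf E) (quadFun q))) (fourSets n))))
        ≡⟨ 𝔼-cong p (pairs n) (λ E → ℕtoℚ-sum (λ q → f (induced (adjOf E) (quadFun q))) (fourSets n)) ⟩
      𝔼 p (pairs n) (λ E → sumℚ (map (λ q → ℕtoℚ (f (induced (adjOf E) (quadFun q)))) (fourSets n)))
        ≡⟨ 𝔼-sum p (pairs n) (λ q E → ℕtoℚ (f (induced (adjOf E) (quadFun q)))) (fourSets n) ⟩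
      sumℚ (map (λ q → 𝔼 p (pairs n) (λ E → ℕtoℚ (f (induced (adjOf E) (quadFun q))))) (fourSets n))
        ≡⟨ sumℚ-map-cong-All (All.map (λ {q} inc → per-set (quadFun-increasing q inc)) (all-filter _ (allQuads n))) ⟩
      sumℚ (map (λ _ → c) (fourSets n))
        ≡⟨ sumℚ-map-const c (fourSets n) ⟩
      ℕtoℚ (length (fourSets n)) * c ∎
      where
      open ≡-Reasoning
      cast : ∀ E → ℕtoℚ (weightedCount f (adjOf E)) ≡ sumℚ (map (λ R → ℕtoℚ (f R) * ℕtoℚ (N R (adjOf E))) reps)
      cast E = trans (ℕtoℚ-sum (λ R → f R ℕ.* N R (adjOf E)) reps)
                     (sumℚ-map-cong (λ R → ℕtoℚ-* (f R) (N R (adjOf E))) reps)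

module Deviations where

  open import Defs
  open IncreasingSums
  open FourVertexGraphs
  open Counting
  open Rationals
  open RandomSublists
  open RandomGraph
  open import Data.Nat as ℕ using (ℕ)
  import Data.Nat.ListAction as List
  open import Data.Fin as Fin using (Fin)
  open import Data.List using (List; []; _∷_; map; length)
  import Data.List.Properties as ListP
  open import Data.List.Relation.Unary.All as All using (All; []; _∷_; all?)
  import Data.List.Relation.Unary.All.Properties as AllP
  open import Data.List.Relation.Unary.Any using (here; there)
  open import Data.List.Membership.Propositional using (_∈_)
  open import Data.List.Membership.Propositional.Properties using (∈-map⁺)
  import Data.List.Membership.DecPropositional as DecMembership
  open import Data.Product using (_,_)
  import Data.Product.Properties as ProductP
  open import Data.Rational as ℚ using (ℚ; 0ℚ; _+_; _*_; _-_; -_; _≤_)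
  import Data.Rational.Properties as ℚP
  open import Data.Rational.Solver using (module +-*-Solver)
  open +-*-Solver using (solve; _:*_; _:-_; :-_; con; _:=_)
  open import Relation.Nullary.Decidable using (toWitness)
  open import Relation.Binary.PropositionalEquality

  maxℚ-upper : ∀ x xs {y} → y ∈ xs → y ≤ maxℚ x xs
  maxℚ-upper x (z ∷ xs) (here refl) = ℚP.p≤p⊔q z (maxℚ x xs)
  maxℚ-upper x (z ∷ xs) (there y∈) = ℚP.p≤q⇒p≤r⊔q z (maxℚ-upper x xs y∈)

  repEdgeSets⊆subsets : All (_∈ subsets (pairs 4)) repEdgeSets
  repEdgeSets⊆subsets = toWitness {a? = all? (_∈? subsets (pairs 4)) repEdgeSets} _
    where open DecMembership (ListP.≡-dec (ProductP.≡-dec Fin._≟_ Fin._≟_))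

  deviation : ∀ {n} → Adj n → ℚ → Adj 4 → ℚ
  deviation {n} G p R = ℕtoℚ (N R G) - expectedN n p R

  deviation≤u4 : ∀ {n} (G : Adj n) p {R} → R ∈ graphs4 → deviation G p R ≤ u4 G p
  deviation≤u4 G p R∈ = maxℚ-upper (deviation G p emptyAdj4) (map (deviation G p) graphs4) (∈-map⁺ (deviation G p) R∈)

  reps-deviation≤u4 : ∀ {n} (G : Adj n) p → All (λ R → deviation G p R ≤ u4 G p) reps
  reps-deviation≤u4 G p = AllP.map⁺ {P = λ R → deviation G p R ≤ u4 G p} {f = adjOf}
    (All.map {Q = λ E → deviation G p (adjOf E) ≤ u4 G p}
             (λ {E} E∈ → deviation≤u4 G p {adjOf E} (∈-map⁺ adjOf {xs = subsets (pairs 4)} E∈)) repEdgeSets⊆subsets)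

  module _ {A : Set} where

    weighted-sum-≤ : ∀ (w d : A → ℚ) u xs → All (λ x → d x ≤ u) xs → All (λ x → 0ℚ ≤ w x) xs →
                     sumℚ (map (λ x → w x * d x) xs) ≤ sumℚ (map w xs) * u
    weighted-sum-≤ w d u []       []           []           = ℚP.≤-reflexive (sym (ℚP.*-zeroˡ u))
    weighted-sum-≤ w d u (x ∷ xs) (d≤u ∷ ds≤u) (0≤w ∷ 0≤ws) =
      subst (w x * d x + sumℚ (map (λ x → w x * d x) xs) ≤_) (sym (ℚP.*-distribʳ-+ u (w x) (sumℚ (map w xs))))
            (ℚP.+-mono-≤ (ℚP.*-monoˡ-≤-nonNeg (w x) {{ℚ.nonNegative 0≤w}} d≤u) (weighted-sum-≤ w d u xs ds≤u 0≤ws))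

    weighted-sum-≥ : ∀ (w d : A → ℚ) c u xs → sumℚ (map d xs) ≡ 0ℚ → All (λ x → d x ≤ u) xs → All (λ x → w x ≤ c) xs →
                     - sumℚ (map (λ x → w x * d x) xs) ≤ sumℚ (map (λ x → c - w x) xs) * u
    weighted-sum-≥ w d c u xs Σd≡0 ds≤u ws≤c =
      subst (_≤ sumℚ (map (λ x → c - w x) xs) * u)
            (begin
              sumℚ (map (λ x → (c - w x) * d x) xs)
                ≡⟨ sumℚ-map-cong (λ x → *-distribʳ-- c (w x) (d x)) xs ⟩
              sumℚ (map (λ x → c * d x - w x * d x) xs)
                ≡⟨ sumℚ-map-- (λ x → c * d x) (λ x → w x * d x) xs ⟩
              sumℚ (map (λ x → c * d x) xs) - sumℚ (map (λ x → w x * d x) xs)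
                ≡⟨ cong (_- sumℚ (map (λ x → w x * d x) xs)) (trans (sumℚ-map-*ˡ c d xs) (cong (c *_) Σd≡0)) ⟩
              c * 0ℚ - sumℚ (map (λ x → w x * d x) xs)
                ≡⟨ c*0-s c _ ⟩
              - sumℚ (map (λ x → w x * d x) xs) ∎)
            (weighted-sum-≤ (λ x → c - w x) d u xs ds≤u (All.map ≤⇒0≤- ws≤c))
      where
      open ≡-Reasoning
      *-distribʳ-- : ∀ c w d → (c - w) * d ≡ c * d - w * d
      *-distribʳ-- = solve 3 (λ c w d → (c :- w) :* d := c :* d :- w :* d) refl
      c*0-s : ∀ c s → c * 0ℚ - s ≡ - s
      c*0-s = solve 2 (λ c s → c :* con 0ℚ :- s := :- s) refl

  module _ (p : ℚ) {n : ℕ} (G : SimpleGraph n) where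

    private
      g : Adj n
      g = SimpleGraph.adj G

    deviationSum : (Adj 4 → ℕ) → ℚ
    deviationSum f = sumℚ (map (λ R → ℕtoℚ (f R) * deviation g p R) reps)

    deviationSum≡ : ∀ f → IsClassFunction f → ∀ c →
      (∀ {w : Fin 4 → Fin n} → Increasing₄ w → 𝔼 p (pairs n) (λ E → ℕtoℚ (f (induced (adjOf E) w))) ≡ c) →
      deviationSum f ≡ ℕtoℚ (∑₄ n (λ a b c d → f (induced g (quadFun (a , b , c , d))))) - ℕtoℚ (length (fourSets n)) * c
    deviationSum≡ f class c per-set = begin
      sumℚ (map (λ R → ℕtoℚ (f R) * (ℕtoℚ (N R g) - expectedN n p R)) reps)
        ≡⟨ sumℚ-map-cong (λ R → *-distribˡ-- (ℕtoℚ (f R)) (ℕtoℚ (N R g)) (expectedN n p R)) reps ⟩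
      sumℚ (map (λ R → ℕtoℚ (f R) * ℕtoℚ (N R g) - ℕtoℚ (f R) * expectedN n p R) reps)
        ≡⟨ sumℚ-map-- (λ R → ℕtoℚ (f R) * ℕtoℚ (N R g)) (λ R → ℕtoℚ (f R) * expectedN n p R) reps ⟩
      sumℚ (map (λ R → ℕtoℚ (f R) * ℕtoℚ (N R g)) reps) - sumℚ (map (λ R → ℕtoℚ (f R) * expectedN n p R) reps)
        ≡⟨ cong₂ _-_ (sym observed) (expected-weightedCount p n f class c per-set) ⟩
      ℕtoℚ (∑₄ n (λ a b c d → f (induced g (quadFun (a , b , c , d))))) - ℕtoℚ (length (fourSets n)) * c ∎
      where
      open ≡-Reasoning
      *-distribˡ-- : ∀ w a b → w * (a - b) ≡ w * a - w * b
      *-distribˡ-- = solve 3 (λ w a b → w :* (a :- b) := w :* a :- w :* b) refl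
      observed : ℕtoℚ (∑₄ n (λ a b c d → f (induced g (quadFun (a , b , c , d)))))
                 ≡ sumℚ (map (λ R → ℕtoℚ (f R) * ℕtoℚ (N R g)) reps)
      observed = begin
        ℕtoℚ (∑₄ n (λ a b c d → f (induced g (quadFun (a , b , c , d)))))
          ≡⟨ cong ℕtoℚ (sym (trans (weightedCount-fourSets f class G) (sum-fourSets n (λ q → f (induced g (quadFun q)))))) ⟩
        ℕtoℚ (weightedCount f g)
          ≡⟨ ℕtoℚ-sum (λ R → f R ℕ.* N R g) reps ⟩
        sumℚ (map (λ R → ℕtoℚ (f R ℕ.* N R g)) reps)
          ≡⟨ sumℚ-map-cong (λ R → ℕtoℚ-* (f R) (N R g)) reps ⟩
        sumℚ (map (λ R → ℕtoℚ (f R) * ℕtoℚ (N R g)) reps) ∎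

module Inequality where

  open import Defs using (ℕtoℚ)
  open Rationals
  open import Data.Rational.Solver using (module +-*-Solver)
  open +-*-Solver using (solve; _:+_; _:*_; _:-_; :-_; con; _:=_)
  open import Data.Bool using (T)
  open import Data.Rational as ℚ using (ℚ; 0ℚ; 1ℚ; _+_; _*_; _-_; -_; _≤_; _<_; _≤ᵇ_; _≤?_)
  import Data.Rational.Properties as ℚP
  open import Data.Sum using (inj₁; inj₂)
  open import Relation.Nullary using (yes; no)
  open import Relation.Binary.PropositionalEquality

  ε : ℚ
  ε = 1 ÷ 2000

  -- With n = 4 + t: K t = (n − 2)(n − 3) and m t = n(n − 1); D stands for 2e − p n(n − 1),
  -- twice the excess of the number e of edges over its expectation.
  K m : ℚ → ℚ
  K t = (ℕtoℚ 2 + t) * (1ℚ + t)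
  m t = (ℕtoℚ 4 + t) * (ℕtoℚ 3 + t)

  X R : ℚ → ℚ → ℚ → ℚ
  X t p D = D * D + ℕtoℚ 2 * (p * m t - 1ℚ) * D
  R t p D = X t p D - ℕtoℚ 2 * m t * p * (1ℚ - p)

  module _ (t p u D : ℚ) (0≤t : 0ℚ ≤ t) (0<p : 0ℚ < p) (p<1 : p < 1ℚ) (0≤u : 0ℚ ≤ u) where

    private
      0≤p : 0ℚ ≤ p
      0≤p = ℚP.<⇒≤ 0<p
      0≤q : 0ℚ ≤ 1ℚ - p
      0≤q = ≤⇒0≤- (ℚP.<⇒≤ p<1)
      0≤poly : ∀ a b c → T (0ℚ ≤ᵇ a) → T (0ℚ ≤ᵇ b) → T (0ℚ ≤ᵇ c) → 0ℚ ≤ a + b * t + c * t * t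
      0≤poly a b c 0≤a 0≤b 0≤c =
        0≤-+ (0≤-+ (0≤-const a 0≤a) (0≤-* (0≤-const b 0≤b) 0≤t)) (0≤-* (0≤-* (0≤-const c 0≤c) 0≤t) 0≤t)

    private
      N : ℚ
      N = ℕtoℚ 4 + t

    lower-bound-if-K≤132u : K t ≤ ℕtoℚ 132 * u → ε * p * (1ℚ - p) * (N * N) ≤ u
    lower-bound-if-K≤132u K≤132u = 0≤-⇒≤ (0≤-cancelˡ (ℕtoℚ 132) (ℚP.positive⁻¹ _) (0≤-≡ (sym (identity t p u))
      (0≤-+ (0≤-+ (≤⇒0≤- K≤132u) (0≤poly (1736 ÷ 1000) (2868 ÷ 1000) (9835 ÷ 10000) _ _ _))
            (0≤-* (0≤-* (0≤-const (ℕtoℚ 132 * ε) _) (0≤-square N)) (0≤-square (p - 1 ÷ 2))))))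
      where
      identity : ∀ t p u →
        ℕtoℚ 132 * (u - ε * p * (1ℚ - p) * ((ℕtoℚ 4 + t) * (ℕtoℚ 4 + t)))
        ≡ (ℕtoℚ 132 * u - (ℕtoℚ 2 + t) * (1ℚ + t)) + (1736 ÷ 1000 + 2868 ÷ 1000 * t + 9835 ÷ 10000 * t * t)
          + ℕtoℚ 132 * ε * ((ℕtoℚ 4 + t) * (ℕtoℚ 4 + t)) * ((p - 1 ÷ 2) * (p - 1 ÷ 2))
      identity = solve 3 (λ t p u →
        con (ℕtoℚ 132) :* (u :- con ε :* p :* (con 1ℚ :- p) :* ((con (ℕtoℚ 4) :+ t) :* (con (ℕtoℚ 4) :+ t)))
        := (con (ℕtoℚ 132) :* u :- (con (ℕtoℚ 2) :+ t) :* (con 1ℚ :+ t))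
           :+ (con (1736 ÷ 1000) :+ con (2868 ÷ 1000) :* t :+ con (9835 ÷ 10000) :* t :* t)
           :+ con (ℕtoℚ 132) :* con ε :* ((con (ℕtoℚ 4) :+ t) :* (con (ℕtoℚ 4) :+ t)) :* ((p :- con (1 ÷ 2)) :* (p :- con (1 ÷ 2)))) refl

    private
      0≤K : 0ℚ ≤ K t
      0≤K = 0≤-* (0≤-+ (0≤-const (ℕtoℚ 2) _) 0≤t) (0≤-+ (0≤-const 1ℚ _) 0≤t)
      0≤m : 0ℚ ≤ m t
      0≤m = 0≤-* (0≤-+ (0≤-const (ℕtoℚ 4) _) 0≤t) (0≤-+ (0≤-const (ℕtoℚ 3) _) 0≤t)
      <K⇒<1 : ∀ {x} → K t * x ≤ ℕtoℚ 132 * u → ℕtoℚ 132 * u < K t → x < 1ℚ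
      <K⇒<1 Kx≤ 132u<K = ℚP.*-cancelˡ-<-nonNeg (K t) {{ℚ.nonNegative 0≤K}}
                           (ℚP.≤-<-trans Kx≤ (subst (ℕtoℚ 132 * u <_) (sym (ℚP.*-identityʳ (K t))) 132u<K))

    0≤1782u-X : ℕtoℚ 132 * u < K t → K t * D ≤ ℕtoℚ 132 * u → - (K t * D) ≤ ℕtoℚ 132 * u →
                      0ℚ ≤ ℕtoℚ 1782 * u - X t p D
    0≤1782u-X 132u<K KD≤ -KD≤ with ℚP.≤-total 0ℚ D
    ... | inj₁ 0≤D = 0≤-≡ (sym (identity t p u D))
          (0≤-+ (0≤-* (0≤-const (27 ÷ 2) _) (≤⇒0≤- KD≤))
                (0≤-* 0≤D (0≤-+ (0≤-+ (≤⇒0≤- (ℚP.<⇒≤ (<K⇒<1 KD≤ 132u<K))) (0≤-* (0≤-* (0≤-const (ℕtoℚ 2) _) 0≤m) 0≤q))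
                                (0≤poly (4 ÷ 1) (53 ÷ 2) (23 ÷ 2) _ _ _))))
      where
      identity : ∀ t p u D →
        ℕtoℚ 1782 * u - (D * D + ℕtoℚ 2 * (p * ((ℕtoℚ 4 + t) * (ℕtoℚ 3 + t)) - 1ℚ) * D)
        ≡ 27 ÷ 2 * (ℕtoℚ 132 * u - (ℕtoℚ 2 + t) * (1ℚ + t) * D)
          + D * ((1ℚ - D) + ℕtoℚ 2 * ((ℕtoℚ 4 + t) * (ℕtoℚ 3 + t)) * (1ℚ - p) + (4 ÷ 1 + 53 ÷ 2 * t + 23 ÷ 2 * t * t))
      identity = solve 4 (λ t p u D →
        con (ℕtoℚ 1782) :* u :- (D :* D :+ con (ℕtoℚ 2) :* (p :* ((con (ℕtoℚ 4) :+ t) :* (con (ℕtoℚ 3) :+ t)) :- con 1ℚ) :* D)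
        := con (27 ÷ 2) :* (con (ℕtoℚ 132) :* u :- (con (ℕtoℚ 2) :+ t) :* (con 1ℚ :+ t) :* D)
           :+ D :* ((con 1ℚ :- D) :+ con (ℕtoℚ 2) :* ((con (ℕtoℚ 4) :+ t) :* (con (ℕtoℚ 3) :+ t)) :* (con 1ℚ :- p)
                    :+ (con (4 ÷ 1) :+ con (53 ÷ 2) :* t :+ con (23 ÷ 2) :* t :* t))) refl
    ... | inj₂ D≤0 = 0≤-≡ (sym (identity t p u D))
          (0≤-+ (0≤-* (0≤-const (27 ÷ 2) _) (≤⇒0≤- -KD≤))
                (0≤-* (0≤-neg D≤0) (0≤-+ (0≤-+ (0≤-≡ (1-[-D] D) (≤⇒0≤- (ℚP.<⇒≤ (<K⇒<1 (subst (_≤ ℕtoℚ 132 * u) (ℚP.neg-distribʳ-* (K t) D) -KD≤) 132u<K)))) (0≤-* (0≤-* (0≤-const (ℕtoℚ 2) _) 0≤p) 0≤m))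
                                          (0≤poly (24 ÷ 1) (81 ÷ 2) (27 ÷ 2) _ _ _))))
      where
      1-[-D] : ∀ D → 1ℚ - (- D) ≡ 1ℚ + D
      1-[-D] = solve 1 (λ D → con 1ℚ :- (:- D) := con 1ℚ :+ D) refl
      identity : ∀ t p u D →
        ℕtoℚ 1782 * u - (D * D + ℕtoℚ 2 * (p * ((ℕtoℚ 4 + t) * (ℕtoℚ 3 + t)) - 1ℚ) * D)
        ≡ 27 ÷ 2 * (ℕtoℚ 132 * u - - ((ℕtoℚ 2 + t) * (1ℚ + t) * D))
          + (- D) * ((1ℚ + D) + ℕtoℚ 2 * p * ((ℕtoℚ 4 + t) * (ℕtoℚ 3 + t)) + (24 ÷ 1 + 81 ÷ 2 * t + 27 ÷ 2 * t * t))
      identity = solve 4 (λ t p u D →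
        con (ℕtoℚ 1782) :* u :- (D :* D :+ con (ℕtoℚ 2) :* (p :* ((con (ℕtoℚ 4) :+ t) :* (con (ℕtoℚ 3) :+ t)) :- con 1ℚ) :* D)
        := con (27 ÷ 2) :* (con (ℕtoℚ 132) :* u :- (:- ((con (ℕtoℚ 2) :+ t) :* (con 1ℚ :+ t) :* D)))
           :+ (:- D) :* ((con 1ℚ :+ D) :+ con (ℕtoℚ 2) :* p :* ((con (ℕtoℚ 4) :+ t) :* (con (ℕtoℚ 3) :+ t))
                         :+ (con (24 ÷ 1) :+ con (81 ÷ 2) :* t :+ con (27 ÷ 2) :* t :* t))) refl

    lower-bound-if-132u<K : ℕtoℚ 132 * u < K t → K t * D ≤ ℕtoℚ 132 * u → - (K t * D) ≤ ℕtoℚ 132 * u →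
                       0ℚ ≤ (1ℚ + t) * R t p D + ℕtoℚ 8 * (ℕtoℚ 117 + ℕtoℚ 23 * t) * u →
                       ε * p * (1ℚ - p) * (N * N) ≤ u
    lower-bound-if-132u<K 132u<K KD≤ -KD≤ 0≤R+ = 0≤-⇒≤ (0≤-cancelˡ (ℕtoℚ 2718) (ℚP.positive⁻¹ _) (0≤-≡ (sym (final t p u))
      (0≤-+ pairs-bound (0≤-* (0≤-* 0≤p 0≤q) (0≤poly (2256 ÷ 1000) (3128 ÷ 1000) (641 ÷ 1000) _ _ _)))))
      where
      pairs-bound : 0ℚ ≤ ℕtoℚ 2718 * u - ℕtoℚ 2 * m t * p * (1ℚ - p)
      pairs-bound = 0≤-cancelˡ (1ℚ + t) (ℚP.<-≤-trans (ℚP.positive⁻¹ 1ℚ) (subst (_≤ 1ℚ + t) (ℚP.+-identityʳ 1ℚ) (ℚP.+-monoʳ-≤ 1ℚ 0≤t)))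
        (0≤-≡ (sym (combine t p u (X t p D)))
          (0≤-+ (0≤-+ (0≤-* (0≤-+ (0≤-const 1ℚ _) 0≤t) (0≤1782u-X 132u<K KD≤ -KD≤)) 0≤R+)
                (0≤-* (0≤-* (0≤-const (ℕtoℚ 752) _) 0≤t) 0≤u)))
        where
        combine : ∀ t p u X →
          (1ℚ + t) * (ℕtoℚ 2718 * u - ℕtoℚ 2 * ((ℕtoℚ 4 + t) * (ℕtoℚ 3 + t)) * p * (1ℚ - p))
          ≡ (1ℚ + t) * (ℕtoℚ 1782 * u - X)
            + ((1ℚ + t) * (X - ℕtoℚ 2 * ((ℕtoℚ 4 + t) * (ℕtoℚ 3 + t)) * p * (1ℚ - p)) + ℕtoℚ 8 * (ℕtoℚ 117 + ℕtoℚ 23 * t) * u)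
            + ℕtoℚ 752 * t * u
        combine = solve 4 (λ t p u X →
          (con 1ℚ :+ t) :* (con (ℕtoℚ 2718) :* u :- con (ℕtoℚ 2) :* ((con (ℕtoℚ 4) :+ t) :* (con (ℕtoℚ 3) :+ t)) :* p :* (con 1ℚ :- p))
          := (con 1ℚ :+ t) :* (con (ℕtoℚ 1782) :* u :- X)
             :+ ((con 1ℚ :+ t) :* (X :- con (ℕtoℚ 2) :* ((con (ℕtoℚ 4) :+ t) :* (con (ℕtoℚ 3) :+ t)) :* p :* (con 1ℚ :- p))
                 :+ con (ℕtoℚ 8) :* (con (ℕtoℚ 117) :+ con (ℕtoℚ 23) :* t) :* u)
             :+ con (ℕtoℚ 752) :* t :* u) refl
      final : ∀ t p u →
        ℕtoℚ 2718 * (u - ε * p * (1ℚ - p) * ((ℕtoℚ 4 + t) * (ℕtoℚ 4 + t)))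
        ≡ (ℕtoℚ 2718 * u - ℕtoℚ 2 * ((ℕtoℚ 4 + t) * (ℕtoℚ 3 + t)) * p * (1ℚ - p))
          + p * (1ℚ - p) * (2256 ÷ 1000 + 3128 ÷ 1000 * t + 641 ÷ 1000 * t * t)
      final = solve 3 (λ t p u →
        con (ℕtoℚ 2718) :* (u :- con ε :* p :* (con 1ℚ :- p) :* ((con (ℕtoℚ 4) :+ t) :* (con (ℕtoℚ 4) :+ t)))
        := (con (ℕtoℚ 2718) :* u :- con (ℕtoℚ 2) :* ((con (ℕtoℚ 4) :+ t) :* (con (ℕtoℚ 3) :+ t)) :* p :* (con 1ℚ :- p))
           :+ p :* (con 1ℚ :- p) :* (con (2256 ÷ 1000) :+ con (3128 ÷ 1000) :* t :+ con (641 ÷ 1000) :* t :* t)) refl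

    lower-bound : K t * D ≤ ℕtoℚ 132 * u → - (K t * D) ≤ ℕtoℚ 132 * u →
                  0ℚ ≤ (1ℚ + t) * R t p D + ℕtoℚ 8 * (ℕtoℚ 117 + ℕtoℚ 23 * t) * u →
                  ε * p * (1ℚ - p) * (N * N) ≤ u
    lower-bound KD≤ -KD≤ 0≤R+ with K t ≤? ℕtoℚ 132 * u
    ... | yes K≤132u = lower-bound-if-K≤132u K≤132u
    ... | no  K≰132u = lower-bound-if-132u<K (ℚP.≰⇒> K≰132u) KD≤ -KD≤ 0≤R+

module FourSetTotals where

  open import Defs
  open IncreasingSums
  open FourVertexGraphs
  open Counting
  open import Data.Nat as ℕ using (ℕ; _+_; _*_)
  open import Data.Nat.Tactic.RingSolver using (solve-∀; solve)
  open import Data.Nat.Properties using (+-cancelʳ-≡)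
  open import Data.List using ([]; _∷_)
  open import Data.Bool using (true; false)
  open import Data.Fin using (Fin)
  open import Data.Product using (_,_)
  open import Relation.Binary.PropositionalEquality

  𝟙-idem : ∀ b → 𝟙 b * 𝟙 b ≡ 𝟙 b
  𝟙-idem true  = refl
  𝟙-idem false = refl

  module GraphCounts {n} (g : Adj n) where

    edge : Fin n → Fin n → ℕ
    edge a b = 𝟙 (g a b)

    edgeTotal : ℕ
    edgeTotal = ∑₂ n edge

    cherriesIn : Fin n → Fin n → Fin n → ℕ
    cherriesIn a b c = edge a b * edge a c + edge a b * edge b c + edge a c * edge b c

    cherryTotal : ℕ
    cherryTotal = ∑₃ n cherriesIn

    over4Sets : (Adj 4 → ℕ) → ℕ
    over4Sets f = ∑₄ n (λ a b c d → f (induced g (quadFun (a , b , c , d))))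

    over4Sets-vertexCount : 24 * over4Sets vertexCount + 6 * n * n * n + 6 * n ≡ n * n * n * n + 11 * n * n
    over4Sets-vertexCount = ∑₄-ones n

    over4Sets-edgeCount : 2 * over4Sets edgeCount + 5 * n * edgeTotal ≡ n * n * edgeTotal + 6 * edgeTotal
    over4Sets-edgeCount =
      trans (cong (λ z → 2 * z + 5 * n * edgeTotal) (∑₄-cong n λ a b c d → regroup (edge a b) (edge a c) (edge a d) (edge b c) (edge b d) (edge c d)))
            (∑₄-edges n edge)
      where
      regroup : ∀ x₁ x₂ x₃ x₄ x₅ x₆ → x₁ + (x₂ + (x₃ + (x₄ + (x₅ + (x₆ + 0))))) ≡ (x₁ + x₂ + x₃) + (x₄ + x₅ + x₆)
      regroup = solve-∀

    over4Sets-cherryCount : over4Sets cherryCount + 3 * cherryTotal ≡ n * cherryTotal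
    over4Sets-cherryCount =
      trans (cong (_+ 3 * cherryTotal) (∑₄-cong n λ a b c d → regroup (edge a b) (edge a c) (edge a d) (edge b c) (edge b d) (edge c d)))
            (∑₄-triples n cherriesIn)
      where
      regroup : ∀ ab ac ad bc bd cd →
        ab * ac + (ab * bc + (ac * bc + (ab * ad + (ab * bd + (ad * bd + (ac * ad + (ac * cd + (ad * cd
          + (bc * bd + (bc * cd + (bd * cd + 0)))))))))))
        ≡ ((ab * ac + ab * bc + ac * bc) + (ab * ad + ab * bd + ad * bd) + (ac * ad + ac * cd + ad * cd))
          + (bc * bd + bc * cd + bd * cd)
      regroup = solve-∀

    over4Sets-matchingCount : 2 * over4Sets matchingCount + 2 * cherryTotal + edgeTotal ≡ edgeTotal * edgeTotal
    over4Sets-matchingCount =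
      trans (cong₂ (λ x y → 2 * x + 2 * cherryTotal + y)
                   (∑₄-cong n λ a b c d → regroup (edge a b * edge c d) (edge a c * edge b d) (edge a d * edge b c))
                   (sym (∑₂-cong n λ a b → 𝟙-idem (g a b))))
            (∑₂-square n edge)
      where
      regroup : ∀ x y z → x + (y + (z + 0)) ≡ x + y + z
      regroup = solve-∀

  module _ (k : ℕ) where

    edge-identity-solved : ∀ T e → 2 * T + 5 * (4 + k) * e ≡ (4 + k) * (4 + k) * e + 6 * e → 2 * T ≡ (2 + k) * (1 + k) * e
    edge-identity-solved T e eq = +-cancelʳ-≡ (5 * (4 + k) * e) (2 * T) ((2 + k) * (1 + k) * e) (trans eq (solve (k ∷ e ∷ [])))

    vertex-identity-solved : ∀ Q → 24 * Q + 6 * (4 + k) * (4 + k) * (4 + k) + 6 * (4 + k) ≡ (4 + k) * (4 + k) * (4 + k) * (4 + k) + 11 * (4 + k) * (4 + k) →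
                      24 * Q ≡ (4 + k) * (3 + k) * ((2 + k) * (1 + k))
    vertex-identity-solved Q eq = +-cancelʳ-≡ (6 * (4 + k) * (4 + k) * (4 + k) + 6 * (4 + k)) (24 * Q) ((4 + k) * (3 + k) * ((2 + k) * (1 + k)))
      (begin
        24 * Q + (6 * (4 + k) * (4 + k) * (4 + k) + 6 * (4 + k))
          ≡⟨ solve (Q ∷ k ∷ []) ⟩
        24 * Q + 6 * (4 + k) * (4 + k) * (4 + k) + 6 * (4 + k)
          ≡⟨ eq ⟩
        (4 + k) * (4 + k) * (4 + k) * (4 + k) + 11 * (4 + k) * (4 + k)
          ≡⟨ solve (k ∷ []) ⟩
        (4 + k) * (3 + k) * ((2 + k) * (1 + k)) + (6 * (4 + k) * (4 + k) * (4 + k) + 6 * (4 + k)) ∎)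
      where open ≡-Reasoning

    cherry-identity-solved : ∀ T C → T + 3 * C ≡ (4 + k) * C → T ≡ (1 + k) * C
    cherry-identity-solved T C eq = +-cancelʳ-≡ (3 * C) T ((1 + k) * C) (trans eq (solve (k ∷ C ∷ [])))

module LowerBound where

  open import Defs
  open IncreasingSums
  open FourVertexGraphs
  open Counting
  open Rationals
  open RandomSublists
  open RandomGraph
  open Deviations
  open Inequality
  open FourSetTotals
  open import Data.Nat as ℕ using (ℕ; _∸_)
  import Data.Nat.Properties as ℕP
  open import Data.List using (map; length)
  open import Data.List.Relation.Unary.All as All using (All)
  open import Data.Rational using (ℚ; 0ℚ; 1ℚ; _+_; _*_; _-_; -_; _≤_; _<_)
  import Data.Rational.Properties as ℚP
  open import Data.Rational.Solver using (module +-*-Solver)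
  open +-*-Solver using (solve; _:+_; _:*_; _:-_; :-_; con; _:=_)
  open import Relation.Binary.PropositionalEquality

  edge-deviation-form : ∀ Te Q E t p →
    ℕtoℚ 2 * Te ≡ K t * E → ℕtoℚ 24 * Q ≡ m t * K t →
    Te - Q * (ℕtoℚ 6 * p) ≡ (1 ÷ 4) * (K t * (ℕtoℚ 2 * E - p * m t))
  edge-deviation-form Te Q E t p 2Te≡ 24Q≡ = begin
    Te - Q * (ℕtoℚ 6 * p)
      ≡⟨ halve Te Q p ⟩
    (1 ÷ 2) * (ℕtoℚ 2 * Te) - (1 ÷ 24) * (ℕtoℚ 24 * Q) * (ℕtoℚ 6 * p)
      ≡⟨ cong₂ (λ a b → (1 ÷ 2) * a - (1 ÷ 24) * b * (ℕtoℚ 6 * p)) 2Te≡ 24Q≡ ⟩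
    (1 ÷ 2) * (K t * E) - (1 ÷ 24) * (m t * K t) * (ℕtoℚ 6 * p)
      ≡⟨ collect t E p ⟩
    (1 ÷ 4) * (K t * (ℕtoℚ 2 * E - p * m t)) ∎
    where
    open ≡-Reasoning
    halve : ∀ Te Q p → Te - Q * (ℕtoℚ 6 * p) ≡ (1 ÷ 2) * (ℕtoℚ 2 * Te) - (1 ÷ 24) * (ℕtoℚ 24 * Q) * (ℕtoℚ 6 * p)
    halve = solve 3 (λ Te Q p → Te :- Q :* (con (ℕtoℚ 6) :* p)
                    := con (1 ÷ 2) :* (con (ℕtoℚ 2) :* Te) :- con (1 ÷ 24) :* (con (ℕtoℚ 24) :* Q) :* (con (ℕtoℚ 6) :* p)) refl
    collect : ∀ t E p → (1 ÷ 2) * (K t * E) - (1 ÷ 24) * (m t * K t) * (ℕtoℚ 6 * p) ≡ (1 ÷ 4) * (K t * (ℕtoℚ 2 * E - p * m t))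
    collect = solve 3 (λ t E p →
      con (1 ÷ 2) :* (((con (ℕtoℚ 2) :+ t) :* (con 1ℚ :+ t)) :* E)
        :- con (1 ÷ 24) :* (((con (ℕtoℚ 4) :+ t) :* (con (ℕtoℚ 3) :+ t)) :* ((con (ℕtoℚ 2) :+ t) :* (con 1ℚ :+ t))) :* (con (ℕtoℚ 6) :* p)
      := con (1 ÷ 4) :* (((con (ℕtoℚ 2) :+ t) :* (con 1ℚ :+ t))
                         :* (con (ℕtoℚ 2) :* E :- p :* ((con (ℕtoℚ 4) :+ t) :* (con (ℕtoℚ 3) :+ t))))) refl

  pair-deviation-form : ∀ TD TS Q E C t p u →
    ℕtoℚ 2 * TD + ℕtoℚ 2 * C + E ≡ E * E → TS ≡ (1ℚ + t) * C → ℕtoℚ 24 * Q ≡ m t * K t →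
    ℕtoℚ 8 * ((1ℚ + t) * (ℕtoℚ 23 * u - - (TD - Q * (ℕtoℚ 3 * (p * p)))) + (ℕtoℚ 94 * u - - (TS - Q * (ℕtoℚ 12 * (p * p)))))
    ≡ (1ℚ + t) * R t p (ℕtoℚ 2 * E - p * m t) + ℕtoℚ 8 * (ℕtoℚ 117 + ℕtoℚ 23 * t) * u
  pair-deviation-form TD TS Q E C t p u A≡ TS≡ 24Q≡ = begin
    ℕtoℚ 8 * ((1ℚ + t) * (ℕtoℚ 23 * u - - (TD - Q * (ℕtoℚ 3 * (p * p)))) + (ℕtoℚ 94 * u - - (TS - Q * (ℕtoℚ 12 * (p * p)))))
      ≡⟨ expand TD TS Q E C t p u ⟩
    combination (ℕtoℚ 2 * TD + ℕtoℚ 2 * C + E) TS (ℕtoℚ 24 * Q)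
      ≡⟨ cong₂ (λ a b → combination a TS b) A≡ 24Q≡ ⟩
    combination (E * E) TS (m t * K t)
      ≡⟨ cong (λ s → combination (E * E) s (m t * K t)) TS≡ ⟩
    combination (E * E) ((1ℚ + t) * C) (m t * K t)
      ≡⟨ collect E C t p u ⟩
    (1ℚ + t) * R t p (ℕtoℚ 2 * E - p * m t) + ℕtoℚ 8 * (ℕtoℚ 117 + ℕtoℚ 23 * t) * u ∎
    where
    open ≡-Reasoning
    combination : ℚ → ℚ → ℚ → ℚ
    combination A S B = ℕtoℚ 4 * (1ℚ + t) * A - ℕtoℚ 4 * (1ℚ + t) * E - ℕtoℚ 8 * (1ℚ + t) * C + ℕtoℚ 8 * S
                        - (ℕtoℚ 5 + t) * (p * p) * B + ℕtoℚ 8 * (ℕtoℚ 117 + ℕtoℚ 23 * t) * u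
    expand : ∀ TD TS Q E C t p u →
      ℕtoℚ 8 * ((1ℚ + t) * (ℕtoℚ 23 * u - - (TD - Q * (ℕtoℚ 3 * (p * p)))) + (ℕtoℚ 94 * u - - (TS - Q * (ℕtoℚ 12 * (p * p)))))
      ≡ ℕtoℚ 4 * (1ℚ + t) * (ℕtoℚ 2 * TD + ℕtoℚ 2 * C + E) - ℕtoℚ 4 * (1ℚ + t) * E - ℕtoℚ 8 * (1ℚ + t) * C + ℕtoℚ 8 * TS
        - (ℕtoℚ 5 + t) * (p * p) * (ℕtoℚ 24 * Q) + ℕtoℚ 8 * (ℕtoℚ 117 + ℕtoℚ 23 * t) * u
    expand = solve 8 (λ TD TS Q E C t p u →
      con (ℕtoℚ 8) :* ((con 1ℚ :+ t) :* (con (ℕtoℚ 23) :* u :- :- (TD :- Q :* (con (ℕtoℚ 3) :* (p :* p))))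
                       :+ (con (ℕtoℚ 94) :* u :- :- (TS :- Q :* (con (ℕtoℚ 12) :* (p :* p)))))
      := con (ℕtoℚ 4) :* (con 1ℚ :+ t) :* (con (ℕtoℚ 2) :* TD :+ con (ℕtoℚ 2) :* C :+ E) :- con (ℕtoℚ 4) :* (con 1ℚ :+ t) :* E
         :- con (ℕtoℚ 8) :* (con 1ℚ :+ t) :* C :+ con (ℕtoℚ 8) :* TS
         :- (con (ℕtoℚ 5) :+ t) :* (p :* p) :* (con (ℕtoℚ 24) :* Q) :+ con (ℕtoℚ 8) :* (con (ℕtoℚ 117) :+ con (ℕtoℚ 23) :* t) :* u) refl
    collect : ∀ E C t p u →
      ℕtoℚ 4 * (1ℚ + t) * (E * E) - ℕtoℚ 4 * (1ℚ + t) * E - ℕtoℚ 8 * (1ℚ + t) * C + ℕtoℚ 8 * ((1ℚ + t) * C)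
        - (ℕtoℚ 5 + t) * (p * p) * (m t * K t) + ℕtoℚ 8 * (ℕtoℚ 117 + ℕtoℚ 23 * t) * u
      ≡ (1ℚ + t) * R t p (ℕtoℚ 2 * E - p * m t) + ℕtoℚ 8 * (ℕtoℚ 117 + ℕtoℚ 23 * t) * u
    collect = solve 5 (λ E C t p u →
      con (ℕtoℚ 4) :* (con 1ℚ :+ t) :* (E :* E) :- con (ℕtoℚ 4) :* (con 1ℚ :+ t) :* E
        :- con (ℕtoℚ 8) :* (con 1ℚ :+ t) :* C :+ con (ℕtoℚ 8) :* ((con 1ℚ :+ t) :* C)
        :- (con (ℕtoℚ 5) :+ t) :* (p :* p) :* (((con (ℕtoℚ 4) :+ t) :* (con (ℕtoℚ 3) :+ t)) :* ((con (ℕtoℚ 2) :+ t) :* (con 1ℚ :+ t)))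
        :+ con (ℕtoℚ 8) :* (con (ℕtoℚ 117) :+ con (ℕtoℚ 23) :* t) :* u
      := (con 1ℚ :+ t) :* (dd E t p :* dd E t p :+ con (ℕtoℚ 2) :* (p :* mm t :- con 1ℚ) :* dd E t p
                           :- con (ℕtoℚ 2) :* mm t :* p :* (con 1ℚ :- p))
         :+ con (ℕtoℚ 8) :* (con (ℕtoℚ 117) :+ con (ℕtoℚ 23) :* t) :* u) refl
      where
      mm = λ t → (con (ℕtoℚ 4) :+ t) :* (con (ℕtoℚ 3) :+ t)
      dd = λ E t p → con (ℕtoℚ 2) :* E :- p :* mm t

  quadruple : ∀ x u → (1 ÷ 4) * x ≤ ℕtoℚ 33 * u → x ≤ ℕtoℚ 132 * u
  quadruple x u ¼x≤ = 0≤-⇒≤ (0≤-≡ (sym (times4 x u)) (0≤-* (0≤-const (ℕtoℚ 4) _) (≤⇒0≤- ¼x≤)))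
    where
    times4 : ∀ x u → ℕtoℚ 132 * u - x ≡ ℕtoℚ 4 * (ℕtoℚ 33 * u - (1 ÷ 4) * x)
    times4 = solve 2 (λ x u → con (ℕtoℚ 132) :* u :- x := con (ℕtoℚ 4) :* (con (ℕtoℚ 33) :* u :- con (1 ÷ 4) :* x)) refl

  module _ (p : ℚ) (0<p : 0ℚ < p) (p<1 : p < 1ℚ) {n : ℕ} (4≤n : 4 ℕ.≤ n) (G : SimpleGraph n) where

    private
      g = SimpleGraph.adj G
      u = u4 g p
      k = n ∸ 4
      t = ℕtoℚ k
      open GraphCounts g
      E = ℕtoℚ edgeTotal
      C = ℕtoℚ cherryTotal
      Q = length (fourSets n)

      n≡4+k : n ≡ 4 ℕ.+ k
      n≡4+k = sym (ℕP.m+[n∸m]≡n 4≤n)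

      over4Sets≡Q : over4Sets vertexCount ≡ Q
      over4Sets≡Q = trans (sym (sum-fourSets n (λ _ → 1))) (sum-map-one (fourSets n))

      0≤t : 0ℚ ≤ t
      0≤t = 0≤ℕtoℚ k

      N≡4+t : ℕtoℚ n ≡ ℕtoℚ 4 + t
      N≡4+t = trans (cong ℕtoℚ n≡4+k) (ℕtoℚ-+ 4 k)

      edgeTotal-form : ℕtoℚ 2 * ℕtoℚ (over4Sets edgeCount) ≡ K t * E
      edgeTotal-form = cast-≡ (ℕtoℚ-* 2 (over4Sets edgeCount))
        (trans (ℕtoℚ-*₃ (2 ℕ.+ k) (1 ℕ.+ k) edgeTotal) (cong₂ (λ a b → a * b * E) (ℕtoℚ-+ 2 k) (ℕtoℚ-+ 1 k)))
        (edge-identity-solved k (over4Sets edgeCount) edgeTotal (subst (λ N → 2 ℕ.* over4Sets edgeCount ℕ.+ 5 ℕ.* N ℕ.* edgeTotal ≡ N ℕ.* N ℕ.* edgeTotal ℕ.+ 6 ℕ.* edgeTotal)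
                                            n≡4+k over4Sets-edgeCount))

      Q-form : ℕtoℚ 24 * ℕtoℚ Q ≡ m t * K t
      Q-form = cast-≡ (ℕtoℚ-* 24 Q)
        (trans (ℕtoℚ-* ((4 ℕ.+ k) ℕ.* (3 ℕ.+ k)) ((2 ℕ.+ k) ℕ.* (1 ℕ.+ k)))
               (cong₂ _*_ (trans (ℕtoℚ-* (4 ℕ.+ k) (3 ℕ.+ k)) (cong₂ _*_ (ℕtoℚ-+ 4 k) (ℕtoℚ-+ 3 k)))
                          (trans (ℕtoℚ-* (2 ℕ.+ k) (1 ℕ.+ k)) (cong₂ _*_ (ℕtoℚ-+ 2 k) (ℕtoℚ-+ 1 k)))))
        (subst (λ Q → 24 ℕ.* Q ≡ (4 ℕ.+ k) ℕ.* (3 ℕ.+ k) ℕ.* ((2 ℕ.+ k) ℕ.* (1 ℕ.+ k))) over4Sets≡Q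
          (vertex-identity-solved k (over4Sets vertexCount) (subst (λ N → 24 ℕ.* over4Sets vertexCount ℕ.+ 6 ℕ.* N ℕ.* N ℕ.* N ℕ.+ 6 ℕ.* N
                                             ≡ N ℕ.* N ℕ.* N ℕ.* N ℕ.+ 11 ℕ.* N ℕ.* N)
                                      n≡4+k over4Sets-vertexCount)))

      cherryCount-form : ℕtoℚ (over4Sets cherryCount) ≡ (1ℚ + t) * C
      cherryCount-form = cast-≡ refl (trans (ℕtoℚ-* (1 ℕ.+ k) cherryTotal) (cong (_* C) (ℕtoℚ-+ 1 k)))
        (cherry-identity-solved k (over4Sets cherryCount) cherryTotal (subst (λ N → over4Sets cherryCount ℕ.+ 3 ℕ.* cherryTotal ≡ N ℕ.* cherryTotal)
                                                n≡4+k over4Sets-cherryCount))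

      matchingCount-form : ℕtoℚ 2 * ℕtoℚ (over4Sets matchingCount) + ℕtoℚ 2 * C + E ≡ E * E
      matchingCount-form = cast-≡
        (trans (ℕtoℚ-+ (2 ℕ.* over4Sets matchingCount ℕ.+ 2 ℕ.* cherryTotal) edgeTotal)
               (cong (_+ E) (trans (ℕtoℚ-+ (2 ℕ.* over4Sets matchingCount) (2 ℕ.* cherryTotal))
                                   (cong₂ _+_ (ℕtoℚ-* 2 (over4Sets matchingCount)) (ℕtoℚ-* 2 cherryTotal)))))
        (ℕtoℚ-* edgeTotal edgeTotal)
        over4Sets-matchingCount

      deviations≤u : All (λ R → deviation g p R ≤ u) reps
      deviations≤u = reps-deviation≤u4 g p

      deviations-sum : sumℚ (map (deviation g p) reps) ≡ 0ℚ
      deviations-sum = begin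
        sumℚ (map (deviation g p) reps)
          ≡⟨ sumℚ-map-cong (λ R → sym (ℚP.*-identityˡ (deviation g p R))) reps ⟩
        deviationSum p G vertexCount
          ≡⟨ deviationSum≡ p G vertexCount vertexCount-class 1ℚ (λ _ → 𝔼-const p (pairs n) 1ℚ) ⟩
        ℕtoℚ (over4Sets vertexCount) - ℕtoℚ Q * 1ℚ
          ≡⟨ cong (λ x → ℕtoℚ x - ℕtoℚ Q * 1ℚ) over4Sets≡Q ⟩
        ℕtoℚ Q - ℕtoℚ Q * 1ℚ
          ≡⟨ x-x*1 (ℕtoℚ Q) ⟩
        0ℚ ∎
        where
        open ≡-Reasoning
        x-x*1 : ∀ x → x - x * 1ℚ ≡ 0ℚ
        x-x*1 = solve 1 (λ x → x :- x :* con 1ℚ := con 0ℚ) refl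

      0≤u : 0ℚ ≤ u
      0≤u = 0≤-cancelˡ (ℕtoℚ 11) (ℚP.positive⁻¹ _)
        (subst (_≤ ℕtoℚ 11 * u) (trans (sumℚ-map-cong (λ R → ℚP.*-identityˡ (deviation g p R)) reps) deviations-sum)
               (weighted-sum-≤ (λ _ → 1ℚ) (deviation g p) u reps deviations≤u (All.tabulate (λ _ → 0≤ℕtoℚ 1))))

      edge-deviation : deviationSum p G edgeCount ≡ ℕtoℚ (over4Sets edgeCount) - ℕtoℚ Q * (ℕtoℚ 6 * p)
      edge-deviation = deviationSum≡ p G edgeCount edgeCount-class (ℕtoℚ 6 * p) (λ inc → linearStat-expectation p inc slots _)

      matching-deviation : deviationSum p G matchingCount ≡ ℕtoℚ (over4Sets matchingCount) - ℕtoℚ Q * (ℕtoℚ 3 * (p * p))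
      matching-deviation = deviationSum≡ p G matchingCount matchingCount-class (ℕtoℚ 3 * (p * p))
                             (λ inc → quadraticStat-expectation p inc matchings _)

      cherry-deviation : deviationSum p G cherryCount ≡ ℕtoℚ (over4Sets cherryCount) - ℕtoℚ Q * (ℕtoℚ 12 * (p * p))
      cherry-deviation = deviationSum≡ p G cherryCount cherryCount-class (ℕtoℚ 12 * (p * p))
                           (λ inc → quadraticStat-expectation p inc cherries _)

      -- 33, 33, 23 and 94 are the values over the eleven classes of ∑ edgeCount,
      -- ∑ (6 − edgeCount), ∑ (3 − matchingCount) and ∑ (12 − cherryCount).
      edge-deviation≤ : deviationSum p G edgeCount ≤ ℕtoℚ 33 * u
      edge-deviation≤ = weighted-sum-≤ (λ R → ℕtoℚ (edgeCount R)) (deviation g p) u reps deviations≤u (All.tabulate (λ {R} _ → 0≤ℕtoℚ (edgeCount R)))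

      edge-deviation≥ : - deviationSum p G edgeCount ≤ ℕtoℚ 33 * u
      edge-deviation≥ = weighted-sum-≥ (λ R → ℕtoℚ (edgeCount R)) (deviation g p) (ℕtoℚ 6) u reps deviations-sum deviations≤u
                          (all-≤ᵇ (λ R → ℕtoℚ (edgeCount R)) (ℕtoℚ 6) reps _)

      matching-deviation≥ : - deviationSum p G matchingCount ≤ ℕtoℚ 23 * u
      matching-deviation≥ = weighted-sum-≥ (λ R → ℕtoℚ (matchingCount R)) (deviation g p) (ℕtoℚ 3) u reps deviations-sum deviations≤u
                              (all-≤ᵇ (λ R → ℕtoℚ (matchingCount R)) (ℕtoℚ 3) reps _)

      cherry-deviation≥ : - deviationSum p G cherryCount ≤ ℕtoℚ 94 * u
      cherry-deviation≥ = weighted-sum-≥ (λ R → ℕtoℚ (cherryCount R)) (deviation g p) (ℕtoℚ 12) u reps deviations-sum deviations≤u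
                            (all-≤ᵇ (λ R → ℕtoℚ (cherryCount R)) (ℕtoℚ 12) reps _)

      D : ℚ
      D = ℕtoℚ 2 * E - p * m t

      edge-deviation-D : deviationSum p G edgeCount ≡ (1 ÷ 4) * (K t * D)
      edge-deviation-D = trans edge-deviation (edge-deviation-form (ℕtoℚ (over4Sets edgeCount)) (ℕtoℚ Q) E t p edgeTotal-form Q-form)

      KD≤ : K t * D ≤ ℕtoℚ 132 * u
      KD≤ = quadruple (K t * D) u (subst (_≤ ℕtoℚ 33 * u) edge-deviation-D edge-deviation≤)

      -KD≤ : - (K t * D) ≤ ℕtoℚ 132 * u
      -KD≤ = quadruple (- (K t * D)) u
               (subst (_≤ ℕtoℚ 33 * u) (trans (cong -_ edge-deviation-D) (ℚP.neg-distribʳ-* (1 ÷ 4) (K t * D))) edge-deviation≥)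

      0≤R+ : 0ℚ ≤ (1ℚ + t) * R t p D + ℕtoℚ 8 * (ℕtoℚ 117 + ℕtoℚ 23 * t) * u
      0≤R+ = 0≤-≡ (trans (cong₂ (λ x y → ℕtoℚ 8 * ((1ℚ + t) * (ℕtoℚ 23 * u - - x) + (ℕtoℚ 94 * u - - y))) matching-deviation cherry-deviation)
                         (pair-deviation-form (ℕtoℚ (over4Sets matchingCount)) (ℕtoℚ (over4Sets cherryCount)) (ℕtoℚ Q) E C t p u matchingCount-form cherryCount-form Q-form))
                  (0≤-* (0≤-const (ℕtoℚ 8) _)
                        (0≤-+ (0≤-* (0≤-+ (0≤-const 1ℚ _) 0≤t) (≤⇒0≤- matching-deviation≥)) (≤⇒0≤- cherry-deviation≥)))

    u4-lower-bound : ε * p * (1ℚ - p) * (ℕtoℚ n * ℕtoℚ n) ≤ u4 (SimpleGraph.adj G) p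
    u4-lower-bound = subst (λ N → ε * p * (1ℚ - p) * (N * N) ≤ u) (sym N≡4+t)
                           (lower-bound t p u D 0≤t 0<p p<1 0≤u KD≤ -KD≤ 0≤R+)

open import Defs
open import Data.Nat using (ℕ; _≤_)
open import Data.Product using (Σ; _×_; _,_)
open import Data.Rational using (ℚ; 0ℚ; 1ℚ; _*_; _-_; _<_) renaming (_≤_ to _≤ℚ_)
import Data.Rational.Properties as ℚP
open Inequality using (ε)
open LowerBound using (u4-lower-bound)

lemma2p2 : Σ ℚ (λ ε → (0ℚ < ε) × ((p : ℚ) → 0ℚ < p → p < 1ℚ → (n : ℕ) → 4 ≤ n → (G : SimpleGraph n) → (ε * p * (1ℚ - p) * (ℕtoℚ n * ℕtoℚ n)) ≤ℚ u4 (SimpleGraph.adj G) p))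
lemma2p2 = ε , ℚP.positive⁻¹ ε , λ p 0<p p<1 n 4≤n G → u4-lower-bound p 0<p p<1 4≤n G
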